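{- Let $n\ge1$ and let $K$ be a pure $n$-simplicial complex with $p$ vertices. Then $K$ is a simplicial tree if and only if $K$ is connected and $\alpha_k(K)=(p-n)\binom{n}{k}+\binom{n}{k+1}$ for some $1\le k\le n$.
   Context: A simplicial complex on a finite vertex set is a collection of non-empty vertex subsets containing all singletons and closed under non-empty subsets; a $k$-simplex has $k+1$ vertices; $\tau$ is a face of $\sigma$ if $\tau\subseteq\sigma$; $\alpha_k(K)$ is the number of $k$-simplices of $K$. $K$ is a pure $n$-simplicial complex if $\dim K=n$ and every simplex is a face of some $n$-simplex. $\binom{n}{n+1}=0$. Let $0\le m\le n-1$. An $(m,n)$-walk sequence is an alternating sequence $\sigma_1,\eta_1,\sigma_2,\dots,\sigma_r,\eta_r,\sigma_{r+1}$ of $m$-simplices $\sigma_k$ and $n$-simplices $\eta_k$ with $\sigma_k\ne\sigma_{k+1}$ both faces of $\eta_k$; it is an $(m,n)$-path sequence if all its simplices are distinct. $K$ is connected if there is an $(n-1,n)$-path sequence between every pair of distinct $(n-1)$-simplices. An $(m,n)$-simplicial cycle sequence is an $(m,n)$-walk sequence with $\sigma_{r+1}=\sigma_1$, $\sigma_p\neq\sigma_q$ and $\eta_p\ne\eta_q$ for $1\le p\ne q\le r$, such that $r\ge3$, $\sigma_1$ is not a face of $\eta_k$ for $2\le k\le r-1$, and for each $2\le z\le r$ there is an $(n-1)$-simplex $\sigma'_z$ which is a face of $\eta_{z-1}$ and $\eta_z$ and has $\sigma_z$ as a face, with the $\sigma'_z$ pairwise distinct. $K$ is acyclic if it contains no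 $(m,n)$-simplicial cycle sequence for any $0\le m\le n-1$. A simplicial tree is a connected acyclic pure $n$-simplicial complex. -}

module Defs where

open import Data.Nat using (ℕ; zero; suc; _+_; _*_; _∸_; _≤_; _<_; _≡ᵇ_)
open import Data.Nat.Combinatorics using (_C_)
open import Data.Bool using (Bool; true; false; _∧_)
open import Data.Vec using (Vec; []; _∷_)
open import Data.List using (List; []; _∷_; _++_; map; length; filterᵇ)
open import Data.Fin using (Fin)
open import Data.Fin.Subset using (Subset; _⊆_; ∣_∣; Nonempty; ⁅_⁆; ⊥)
open import Data.Product using (Σ; ∃; _×_; _,_)
open import Relation.Binary.PropositionalEquality using (_≡_; _≢_)
open import Relation.Nullary using (¬_)

record Complex (p : ℕ) : Set where
  field
    mem        : Subset p → Bool
    empty-out  : mem ⊥ ≡ false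
    singletons : ∀ (x : Fin p) → mem ⁅ x ⁆ ≡ true
    closed     : ∀ (s t : Subset p) → mem t ≡ true → Nonempty s → s ⊆ t → mem s ≡ true
open Complex public

module _ {p : ℕ} (K : Complex p) where

  IsSimplex : ℕ → Subset p → Set
  IsSimplex k s = (mem K s ≡ true) × (∣ s ∣ ≡ suc k)

allSubsets : (n : ℕ) → List (Subset n)
allSubsets zero = [] ∷ []
allSubsets (suc n) = map (true ∷_) (allSubsets n) ++ map (false ∷_) (allSubsets n)

α : {p : ℕ} → Complex p → ℕ → ℕ
α {p} K k = length (filterᵇ (λ s → mem K s ∧ (∣ s ∣ ≡ᵇ suc k)) (allSubsets p))

module _ {p : ℕ} (K : Complex p) where

  Pure : ℕ → Set
  Pure n = (∃ λ s → IsSimplex K n s)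
         × (∀ (s : Subset p) → mem K s ≡ true → ∣ s ∣ ≤ suc n)
         × (∀ (s : Subset p) → mem K s ≡ true → ∃ λ t → IsSimplex K n t × s ⊆ t)

  -- (m,n)-walk sequence σ_1,η_1,…,σ_r,η_r,σ_{r+1} (indices 1-based as in the paper)
  IsWalk : ℕ → ℕ → ℕ → (ℕ → Subset p) → (ℕ → Subset p) → Set
  IsWalk m n r σ η =
      (∀ k → 1 ≤ k → k ≤ suc r → IsSimplex K m (σ k))
    × (∀ k → 1 ≤ k → k ≤ r → IsSimplex K n (η k))
    × (∀ k → 1 ≤ k → k ≤ r → (σ k ≢ σ (suc k)) × (σ k ⊆ η k) × (σ (suc k) ⊆ η k))

  IsPath : ℕ → ℕ → Subset p → Subset p → Set
  IsPath m n a b = Σ ℕ λ r → Σ (ℕ → Subset p) λ σ → Σ (ℕ → Subset p) λ η →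
      IsWalk m n r σ η
    × (σ 1 ≡ a) × (σ (suc r) ≡ b)
    × (∀ i j → 1 ≤ i → i ≤ suc r → 1 ≤ j → j ≤ suc r → i ≢ j → σ i ≢ σ j)
    × (∀ i j → 1 ≤ i → i ≤ r → 1 ≤ j → j ≤ r → i ≢ j → η i ≢ η j)

  Connected : ℕ → Set
  Connected n = ∀ (a b : Subset p) → IsSimplex K (n ∸ 1) a → IsSimplex K (n ∸ 1) b → a ≢ b →
                IsPath (n ∸ 1) n a b

  IsCycle : ℕ → ℕ → Set
  IsCycle m n = Σ ℕ λ r → Σ (ℕ → Subset p) λ σ → Σ (ℕ → Subset p) λ η →
      IsWalk m n r σ η
    × (σ (suc r) ≡ σ 1)
    × (∀ i j → 1 ≤ i → i ≤ r → 1 ≤ j → j ≤ r → i ≢ j → σ i ≢ σ j)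
    × (∀ i j → 1 ≤ i → i ≤ r → 1 ≤ j → j ≤ r → i ≢ j → η i ≢ η j)
    × (3 ≤ r)
    × (∀ k → 2 ≤ k → k ≤ r ∸ 1 → ¬ (σ 1 ⊆ η k))
    × (Σ (ℕ → Subset p) λ σ′ →
          (∀ z → 2 ≤ z → z ≤ r →
              IsSimplex K (n ∸ 1) (σ′ z) × (σ′ z ⊆ η z) × (σ′ z ⊆ η (z ∸ 1)) × (σ z ⊆ σ′ z))
        × (∀ i j → 2 ≤ i → i ≤ r → 2 ≤ j → j ≤ r → i ≢ j → σ′ i ≢ σ′ j))

  Acyclic : ℕ → Set
  Acyclic n = ∀ m → m < n → ¬ IsCycle m n

  SimplicialTree : ℕ → Set
  SimplicialTree n = Connected n × Acyclic n × Pure n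

module Submission where

-- Order the facets so that each meets an earlier one in a ridge (K is connected) and count faces facet
-- by facet. For 1 ≤ k ≤ n, a facet with a vertex not seen before adds one vertex and exactly C(n,k)
-- k-faces; any other facet adds no vertex but at least one k-face. Hence
-- α_k + n·C(n,k) ≥ α_0·C(n,k) + C(n,k+1) = p·C(n,k) + C(n,k+1), with equality iff every facet brings a
-- fresh vertex. That happens iff K is acyclic. Listing the facets η_1, …, η_r of a simplicial cycle first,
-- η_r has no fresh vertex, for otherwise σ_1 ⊆ η_1 ∩ η_r would lie in σ′_r ⊆ η_(r-1). Conversely the first
-- facet without a fresh vertex closes a (0,n)-cycle through a gallery of earlier facets.

open import Defs
import Data.Bool as Bool
open import Data.Bool using (Bool; true; false; _∧_; _∨_; not)
open import Data.Bool.Properties using (∧-zeroʳ; ∧-identityʳ; ∨-identityʳ; ∧-idem)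
open import Data.Empty using (⊥-elim)
open import Data.Fin using (Fin; zero; suc) renaming (_≟_ to _≟ᶠ_)
open import Data.Fin.Properties using () renaming (any? to anyFin?)
open import Data.Fin.Subset
open import Data.Fin.Subset.Properties
open import Data.List using (List; []; _∷_; _++_; map; length; filterᵇ; applyDownFrom)
open import Data.List.Membership.Propositional using (find; lose) renaming (_∈_ to _∈ₗ_)
open import Data.List.Membership.Propositional.Properties using (∈-map⁺; ∈-++⁺ˡ; ∈-++⁺ʳ; ∈-applyDownFrom⁺; ∈-applyDownFrom⁻)
open import Data.List.Properties using (++-assoc)
import Data.List.Relation.Unary.Any as Any
open import Data.List.Relation.Unary.Any using (Any; here; there) renaming (any? to anyList?)
open import Data.Nat using (ℕ; zero; suc; _+_; _*_; _∸_; _≤_; _<_; _≡ᵇ_; z≤n; s≤s; _≤?_; _<?_)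
open import Data.Nat.Combinatorics using (_C_; nCk+nC[k+1]≡[n+1]C[k+1]; nC1≡n)
open import Data.Nat.Properties
open import Data.Nat.Tactic.RingSolver using (solve-∀)
open import Data.Product using (Σ; ∃; _×_; _,_; proj₁; proj₂)
open import Data.Sum using (_⊎_; inj₁; inj₂)
open import Data.Vec using ([]; _∷_; here; there)
import Data.Vec.Properties as Vec
open import Function using (_∘_; case_of_; _⇔_; mk⇔; Equivalence)
open import Relation.Binary.Definitions using (DecidableEquality; tri<; tri≈; tri>)
open import Relation.Binary.PropositionalEquality
open import Relation.Nullary using (¬_; Dec; yes; no; does; contradiction)
open import Relation.Nullary.Decidable using (dec-true; dec-false; _×-dec_; ¬?)

private
  variable
    m : ℕ
    x y : Fin m
    p q : Subset m

p⊆q∧∣q∣≤∣p∣⇒q⊆p : p ⊆ q → ∣ q ∣ ≤ ∣ p ∣ → q ⊆ p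
p⊆q∧∣q∣≤∣p∣⇒q⊆p {p = p} p⊆q ∣q∣≤∣p∣ {x} x∈q with x ∈? p
... | yes x∈p = x∈p
... | no x∉p = contradiction ∣q∣≤∣p∣ (<⇒≱ (p⊂q⇒∣p∣<∣q∣ (p⊆q , x , x∈q , x∉p)))

p⊆q∧∣q∣≤∣p∣⇒p≡q : p ⊆ q → ∣ q ∣ ≤ ∣ p ∣ → p ≡ q
p⊆q∧∣q∣≤∣p∣⇒p≡q p⊆q ∣q∣≤∣p∣ = ⊆-antisym p⊆q (p⊆q∧∣q∣≤∣p∣⇒q⊆p p⊆q ∣q∣≤∣p∣)

p⊈q⇒∃x∈p∖q : ¬ p ⊆ q → ∃ λ x → x ∈ p × x ∉ q
p⊈q⇒∃x∈p∖q {p = []} {q = []} p⊈q = ⊥-elim (p⊈q (λ x∈p → x∈p))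
p⊈q⇒∃x∈p∖q {p = true ∷ p} {q = false ∷ q} p⊈q = zero , here , λ ()
p⊈q⇒∃x∈p∖q {p = true ∷ p} {q = true ∷ q} p⊈q =
  let x , x∈p , x∉q = p⊈q⇒∃x∈p∖q (p⊈q ∘ in⊆in) in suc x , there x∈p , x∉q ∘ drop-there
p⊈q⇒∃x∈p∖q {p = false ∷ p} {q = b ∷ q} p⊈q =
  let x , x∈p , x∉q = p⊈q⇒∃x∈p∖q (p⊈q ∘ out⊆) in suc x , there x∈p , x∉q ∘ drop-there

∣p∣<∣q∣⇒∃x∈q∖p : ∣ p ∣ < ∣ q ∣ → ∃ λ x → x ∈ q × x ∉ p
∣p∣<∣q∣⇒∃x∈q∖p ∣p∣<∣q∣ = p⊈q⇒∃x∈p∖q (λ q⊆p → <⇒≱ ∣p∣<∣q∣ (p⊆q⇒∣p∣≤∣q∣ q⊆p))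

x∈p⇒1+∣p-x∣≡∣p∣ : x ∈ p → suc ∣ p - x ∣ ≡ ∣ p ∣
x∈p⇒1+∣p-x∣≡∣p∣ {p = true ∷ p} here = cong (suc ∘ ∣_∣) (p─⊥≡p p)
x∈p⇒1+∣p-x∣≡∣p∣ {p = true ∷ p} (there x∈p) = cong suc (x∈p⇒1+∣p-x∣≡∣p∣ x∈p)
x∈p⇒1+∣p-x∣≡∣p∣ {p = false ∷ p} (there x∈p) = x∈p⇒1+∣p-x∣≡∣p∣ x∈p

∣q∣≤1+∣p∣⇒q∖p-unique : p ⊆ q → ∣ q ∣ ≤ suc ∣ p ∣ → x ∈ q → x ∉ p → y ∈ q → y ∉ p → y ≡ x
∣q∣≤1+∣p∣⇒q∖p-unique {p = p} {q = q} {x = x} {y = y} p⊆q ∣q∣≤1+∣p∣ x∈q x∉p y∈q y∉p with y ≟ᶠ x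
... | yes y≡x = y≡x
... | no y≢x = contradiction (p⊆q∧∣q∣≤∣p∣⇒q⊆p p⊆q-x ∣q-x∣≤∣p∣ (x∈p∧x≢y⇒x∈p-y y∈q y≢x)) y∉p
  where
  p⊆q-x : p ⊆ q - x
  p⊆q-x z∈p = x∈p∧x≢y⇒x∈p-y (p⊆q z∈p) (λ { refl → x∉p z∈p })
  ∣q-x∣≤∣p∣ : ∣ q - x ∣ ≤ ∣ p ∣
  ∣q-x∣≤∣p∣ = ≤-pred (subst (_≤ suc ∣ p ∣) (sym (x∈p⇒1+∣p-x∣≡∣p∣ x∈q)) ∣q∣≤1+∣p∣)

⊆-interpolate : ∀ (p q : Subset m) j → p ⊆ q → ∣ p ∣ ≤ j → j ≤ ∣ q ∣ →
                ∃ λ r → p ⊆ r × r ⊆ q × ∣ r ∣ ≡ j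
⊆-interpolate [] [] zero _ _ _ = [] , (λ x∈ → x∈) , (λ x∈ → x∈) , refl
⊆-interpolate (true ∷ p) (false ∷ q) j p⊆q _ _ with p⊆q here
... | ()
⊆-interpolate (true ∷ p) (true ∷ q) (suc j) p⊆q (s≤s ∣p∣≤j) (s≤s j≤∣q∣) =
  let r , p⊆r , r⊆q , ∣r∣≡j = ⊆-interpolate p q j (drop-∷-⊆ p⊆q) ∣p∣≤j j≤∣q∣
  in true ∷ r , in⊆in p⊆r , in⊆in r⊆q , cong suc ∣r∣≡j
⊆-interpolate (false ∷ p) (false ∷ q) j p⊆q ∣p∣≤j j≤∣q∣ =
  let r , p⊆r , r⊆q , ∣r∣≡j = ⊆-interpolate p q j (drop-∷-⊆ p⊆q) ∣p∣≤j j≤∣q∣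
  in false ∷ r , out⊆ p⊆r , out⊆ r⊆q , ∣r∣≡j
⊆-interpolate (false ∷ p) (true ∷ q) zero p⊆q ∣p∣≤0 _ =
  let r , p⊆r , r⊆q , ∣r∣≡0 = ⊆-interpolate p q zero (drop-∷-⊆ p⊆q) ∣p∣≤0 z≤n
  in false ∷ r , out⊆ p⊆r , out⊆ r⊆q , ∣r∣≡0
⊆-interpolate (false ∷ p) (true ∷ q) (suc j) p⊆q ∣p∣≤1+j (s≤s j≤∣q∣) with ∣ p ∣ ≤? j
... | yes ∣p∣≤j =
  let r , p⊆r , r⊆q , ∣r∣≡j = ⊆-interpolate p q j (drop-∷-⊆ p⊆q) ∣p∣≤j j≤∣q∣
  in true ∷ r , out⊆ p⊆r , in⊆in r⊆q , cong suc ∣r∣≡j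
... | no ∣p∣≰j =
  let r , p⊆r , r⊆q , ∣r∣≡1+j = ⊆-interpolate p q (suc j) (drop-∷-⊆ p⊆q) ∣p∣≤1+j
                                  (≤-trans (≰⇒> ∣p∣≰j) (p⊆q⇒∣p∣≤∣q∣ (drop-∷-⊆ p⊆q)))
  in false ∷ r , out⊆ p⊆r , out⊆ r⊆q , ∣r∣≡1+j

∣p∣≡1+k⇒Nonempty : ∀ (p : Subset m) {k} → ∣ p ∣ ≡ suc k → Nonempty p
∣p∣≡1+k⇒Nonempty (true ∷ p) _ = zero , here
∣p∣≡1+k⇒Nonempty (false ∷ p) ∣p∣≡1+k = let x , x∈p = ∣p∣≡1+k⇒Nonempty p ∣p∣≡1+k in suc x , there x∈p

x∈p⇒⁅x⁆⊆p : x ∈ p → ⁅ x ⁆ ⊆ p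
x∈p⇒⁅x⁆⊆p {x = x} x∈p y∈⁅x⁆ = subst (_∈ _) (sym (x∈⁅y⁆⇒x≡y x y∈⁅x⁆)) x∈p

⁅⁆-injective : ⁅ x ⁆ ≡ ⁅ y ⁆ → x ≡ y
⁅⁆-injective {x = x} {y} eq = x∈⁅y⁆⇒x≡y y (subst (x ∈_) eq (x∈⁅x⁆ x))

∣p∣≡1∧x∈p⇒p≡⁅x⁆ : ∣ p ∣ ≡ 1 → x ∈ p → p ≡ ⁅ x ⁆
∣p∣≡1∧x∈p⇒p≡⁅x⁆ {x = x} ∣p∣≡1 x∈p =
  sym (p⊆q∧∣q∣≤∣p∣⇒p≡q (x∈p⇒⁅x⁆⊆p x∈p) (≤-reflexive (trans ∣p∣≡1 (sym (∣⁅x⁆∣≡1 x)))))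

∣⁅x⁆∪⁅y⁆∣≤2 : ∀ (x y : Fin m) → ∣ ⁅ x ⁆ ∪ ⁅ y ⁆ ∣ ≤ 2
∣⁅x⁆∪⁅y⁆∣≤2 {suc m} zero zero = s≤s (≤-trans (≤-reflexive (trans (cong ∣_∣ (∪-idem (⊥ {m}))) (∣⊥∣≡0 m))) z≤n)
∣⁅x⁆∪⁅y⁆∣≤2 zero (suc y) = s≤s (≤-reflexive (trans (cong ∣_∣ (∪-identityˡ ⁅ y ⁆)) (∣⁅x⁆∣≡1 y)))
∣⁅x⁆∪⁅y⁆∣≤2 (suc x) zero = s≤s (≤-reflexive (trans (cong ∣_∣ (∪-identityʳ ⁅ x ⁆)) (∣⁅x⁆∣≡1 x)))
∣⁅x⁆∪⁅y⁆∣≤2 (suc x) (suc y) = ∣⁅x⁆∪⁅y⁆∣≤2 x y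

⁅x⁆∪⁅y⁆⊆p : x ∈ p → y ∈ p → ⁅ x ⁆ ∪ ⁅ y ⁆ ⊆ p
⁅x⁆∪⁅y⁆⊆p {x = x} {y = y} x∈p y∈p z∈ with x∈p∪q⁻ ⁅ x ⁆ ⁅ y ⁆ z∈
... | inj₁ z∈⁅x⁆ = x∈p⇒⁅x⁆⊆p x∈p z∈⁅x⁆
... | inj₂ z∈⁅y⁆ = x∈p⇒⁅x⁆⊆p y∈p z∈⁅y⁆

module _ {a} {X : Set a} where

  #filter : (X → Bool) → List X → ℕ
  #filter P xs = length (filterᵇ P xs)

  #filter-∷ : ∀ P x xs → #filter P (x ∷ xs) ≡ (Bool.if P x then suc (#filter P xs) else #filter P xs)
  #filter-∷ P x xs with P x
  ... | true = refl
  ... | false = refl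

  #filter-cong : ∀ {P Q : X → Bool} → (∀ x → P x ≡ Q x) → ∀ xs → #filter P xs ≡ #filter Q xs
  #filter-cong P≗Q [] = refl
  #filter-cong {P} {Q} P≗Q (x ∷ xs)
    rewrite #filter-∷ P x xs | #filter-∷ Q x xs | P≗Q x | #filter-cong P≗Q xs = refl

  #filter-split : ∀ (P Q : X → Bool) xs →
                  #filter P xs ≡ #filter (λ x → P x ∧ Q x) xs + #filter (λ x → P x ∧ not (Q x)) xs
  #filter-split P Q [] = refl
  #filter-split P Q (x ∷ xs)
    rewrite #filter-∷ P x xs | #filter-∷ (λ x → P x ∧ Q x) x xs | #filter-∷ (λ x → P x ∧ not (Q x)) x xs
    with P x | Q x
  ... | true | true = cong suc (#filter-split P Q xs)
  ... | true | false = trans (cong suc (#filter-split P Q xs)) (sym (+-suc _ _))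
  ... | false | _ = #filter-split P Q xs

  #filter-++ : ∀ P xs ys → #filter P (xs ++ ys) ≡ #filter P xs + #filter P ys
  #filter-++ P [] ys = refl
  #filter-++ P (x ∷ xs) ys rewrite #filter-∷ P x (xs ++ ys) | #filter-∷ P x xs with P x
  ... | true = cong suc (#filter-++ P xs ys)
  ... | false = #filter-++ P xs ys

  #filter-pos : ∀ P {x xs} → x ∈ₗ xs → P x ≡ true → 1 ≤ #filter P xs
  #filter-pos P {xs = y ∷ xs} (here refl) Px rewrite #filter-∷ P y xs | Px = s≤s z≤n
  #filter-pos P {xs = y ∷ xs} (there x∈xs) Px rewrite #filter-∷ P y xs with P y
  ... | true = s≤s z≤n
  ... | false = #filter-pos P x∈xs Px

  #filter-none : ∀ xs → #filter (λ _ → false) xs ≡ 0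
  #filter-none [] = refl
  #filter-none (x ∷ xs) = #filter-none xs

#filter-map : ∀ {X Y : Set} (P : Y → Bool) (f : X → Y) xs → #filter P (map f xs) ≡ #filter (P ∘ f) xs
#filter-map P f [] = refl
#filter-map P f (x ∷ xs) rewrite #filter-∷ P (f x) (map f xs) | #filter-∷ (P ∘ f) x xs with P (f x)
... | true = cong suc (#filter-map P f xs)
... | false = #filter-map P f xs

∈-allSubsets : ∀ (s : Subset m) → s ∈ₗ allSubsets m
∈-allSubsets [] = here refl
∈-allSubsets (true ∷ s) = ∈-++⁺ˡ (∈-map⁺ (true ∷_) (∈-allSubsets s))
∈-allSubsets {suc m} (false ∷ s) = ∈-++⁺ʳ (map (true ∷_) (allSubsets m)) (∈-map⁺ (false ∷_) (∈-allSubsets s))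

count : (Subset m → Bool) → ℕ
count {m} P = #filter P (allSubsets m)

count-cong : ∀ {P Q : Subset m → Bool} → (∀ s → P s ≡ Q s) → count P ≡ count Q
count-cong {m} P≗Q = #filter-cong P≗Q (allSubsets m)

count-split : ∀ (P Q : Subset m → Bool) → count P ≡ count (λ s → P s ∧ Q s) + count (λ s → P s ∧ not (Q s))
count-split {m} P Q = #filter-split P Q (allSubsets m)

count-pos : ∀ (P : Subset m → Bool) s → P s ≡ true → 1 ≤ count P
count-pos P s Ps = #filter-pos P (∈-allSubsets s) Ps

count-none : ∀ (P : Subset m → Bool) → (∀ s → P s ≡ false) → count P ≡ 0
count-none {m} P P≗false = trans (count-cong P≗false) (#filter-none (allSubsets m))

count-mono-< : ∀ (P Q : Subset m → Bool) s → (∀ t → Q t ≡ true → P t ≡ true) →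
               P s ≡ true → Q s ≡ false → count Q < count P
count-mono-< P Q s Q⇒P Ps ¬Qs = begin-strict
  count Q                                             <⟨ m<m+n (count Q) (count-pos _ s P∧¬Q-s) ⟩
  count Q + count (λ t → P t ∧ not (Q t))             ≡⟨ cong (_+ count (λ t → P t ∧ not (Q t))) (count-cong P∧Q≗Q) ⟨
  count (λ t → P t ∧ Q t) + count (λ t → P t ∧ not (Q t)) ≡⟨ count-split P Q ⟨
  count P                                             ∎
  where
  open ≤-Reasoning
  P∧Q≗Q : ∀ t → P t ∧ Q t ≡ Q t
  P∧Q≗Q t with Q t in Qt
  ... | true rewrite Q⇒P t Qt = refl
  ... | false = ∧-zeroʳ (P t)
  P∧¬Q-s : P s ∧ not (Q s) ≡ true
  P∧¬Q-s rewrite Ps | ¬Qs = refl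

≡ᵇ-refl : ∀ k → (k ≡ᵇ k) ≡ true
≡ᵇ-refl zero = refl
≡ᵇ-refl (suc k) = ≡ᵇ-refl k

≡ᵇ-true⇒≡ : ∀ {j k} → (j ≡ᵇ k) ≡ true → j ≡ k
≡ᵇ-true⇒≡ {j} {k} j≡ᵇk = ≡ᵇ⇒≡ j k (subst Bool.T (sym j≡ᵇk) _)

sizedSubsetᵇ : Subset m → ℕ → Subset m → Bool
sizedSubsetᵇ A j s = (∣ s ∣ ≡ᵇ j) ∧ does (s ⊆? A)

count-sizedSubset : ∀ (A : Subset m) j → count (sizedSubsetᵇ A j) ≡ ∣ A ∣ C j
count-sizedSubset [] zero = refl
count-sizedSubset [] (suc j) = refl
count-sizedSubset {suc m} (a ∷ A) j = begin
  #filter P (map (true ∷_) (allSubsets m) ++ map (false ∷_) (allSubsets m))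
    ≡⟨ #filter-++ P (map (true ∷_) (allSubsets m)) _ ⟩
  #filter P (map (true ∷_) (allSubsets m)) + #filter P (map (false ∷_) (allSubsets m))
    ≡⟨ cong₂ _+_ (#filter-map P (true ∷_) (allSubsets m)) (#filter-map P (false ∷_) (allSubsets m)) ⟩
  count (P ∘ (true ∷_)) + count (sizedSubsetᵇ A j)
    ≡⟨ cong (count (P ∘ (true ∷_)) +_) (count-sizedSubset A j) ⟩
  count (P ∘ (true ∷_)) + ∣ A ∣ C j
    ≡⟨ with-head a j ⟩
  ∣ a ∷ A ∣ C j
    ∎
  where
  open ≡-Reasoning
  P : Subset (suc m) → Bool
  P = sizedSubsetᵇ (a ∷ A) j
  with-head : ∀ b i → count (sizedSubsetᵇ (b ∷ A) i ∘ (true ∷_)) + ∣ A ∣ C i ≡ ∣ b ∷ A ∣ C i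
  with-head false i = cong (_+ ∣ A ∣ C i) (count-none {m} _ (λ _ → ∧-zeroʳ _))
  with-head true zero = cong (_+ 1) (count-none {m} _ (λ _ → refl))
  with-head true (suc i) = trans (cong (_+ ∣ A ∣ C suc i) (count-sizedSubset A i)) (nCk+nC[k+1]≡[n+1]C[k+1] ∣ A ∣ i)

module _ {a} {X : Set a} where

  infixr 5 _∷ˢ_

  _∷ˢ_ : X → (ℕ → X) → ℕ → X
  (x ∷ˢ f) zero = x
  (x ∷ˢ f) (suc i) = f i

  extendAt : ℕ → X → (ℕ → X) → ℕ → X
  extendAt m x f i with i ≟ m
  ... | yes _ = x
  ... | no _ = f i

  extendAt-≡ : ∀ m x f → extendAt m x f m ≡ x
  extendAt-≡ m x f with m ≟ m
  ... | yes _ = refl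
  ... | no m≢m = contradiction refl m≢m

  extendAt-< : ∀ m x f {i} → i < m → extendAt m x f i ≡ f i
  extendAt-< m x f {i} i<m with i ≟ m
  ... | yes refl = contradiction i<m (<-irrefl refl)
  ... | no _ = refl

distinct-by-< : ∀ {a} {X : Set a} (f : ℕ → X) {b r : ℕ} → (∀ i j → b ≤ i → i < j → j ≤ r → f i ≢ f j) →
                ∀ i j → b ≤ i → i ≤ r → b ≤ j → j ≤ r → i ≢ j → f i ≢ f j
distinct-by-< f distinct< i j b≤i i≤r b≤j j≤r i≢j with <-cmp i j
... | tri< i<j _ _ = distinct< i j b≤i i<j j≤r
... | tri≈ _ i≡j _ = contradiction i≡j i≢j
... | tri> _ _ j<i = distinct< j i b≤j j<i i≤r ∘ sym

module FacetLists {p : ℕ} (K : Complex p) (n : ℕ) where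

  private
    variable
      η θ ζ F G S T : Subset p
      L : List (Subset p)

  Facet : Subset p → Set
  Facet = IsSimplex K n

  Covered : List (Subset p) → Subset p → Set
  Covered L S = Any (S ⊆_) L

  covered? : ∀ L S → Dec (Covered L S)
  covered? L S = anyList? (S ⊆?_) L

  Covered-⊆ : S ⊆ F → Covered L F → Covered L S
  Covered-⊆ S⊆F = Any.map (⊆-trans S⊆F)

  Fresh : List (Subset p) → Fin p → Set
  Fresh L y = ¬ Covered L ⁅ y ⁆

  VerticesCovered : List (Subset p) → Subset p → Set
  VerticesCovered L η = ∀ {y} → y ∈ η → Covered L ⁅ y ⁆

  fresh⇒∉covered : ∀ {y} → Fresh L y → Covered L S → y ∉ S
  fresh⇒∉covered fresh cov y∈S = fresh (Covered-⊆ (x∈p⇒⁅x⁆⊆p y∈S) cov)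

  facet-⊆⇒≡ : Facet η → Facet θ → η ⊆ θ → η ≡ θ
  facet-⊆⇒≡ (_ , ∣η∣≡1+n) (_ , ∣θ∣≡1+n) η⊆θ = p⊆q∧∣q∣≤∣p∣⇒p≡q η⊆θ (≤-reflexive (trans ∣θ∣≡1+n (sym ∣η∣≡1+n)))

  ∈facet∧≢apex⇒∈ridge : Facet η → ∣ G ∣ ≡ n → G ⊆ η → ∀ {y} → y ∈ η → y ∉ G → ∀ {v} → v ∈ η → v ≢ y → v ∈ G
  ∈facet∧≢apex⇒∈ridge {η = η} {G = G} (_ , ∣η∣≡1+n) ∣G∣≡n G⊆η y∈η y∉G {v} v∈η v≢y with v ∈? G
  ... | yes v∈G = v∈G
  ... | no v∉G = contradiction (∣q∣≤1+∣p∣⇒q∖p-unique G⊆η ∣η∣≤1+∣G∣ y∈η y∉G v∈η v∉G) v≢y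
    where
    ∣η∣≤1+∣G∣ : ∣ η ∣ ≤ suc ∣ G ∣
    ∣η∣≤1+∣G∣ = ≤-reflexive (trans ∣η∣≡1+n (cong suc (sym ∣G∣≡n)))

  -- Facet lists are built by consing, so the head is the most recently added facet.
  data Chained : List (Subset p) → Set where
    start  : Facet η → Chained (η ∷ [])
    extend : Chained L → Facet η → ¬ η ∈ₗ L →
             (F : Subset p) → ∣ F ∣ ≡ n → F ⊆ η → Covered L F → Chained (η ∷ L)

  data Stacked : List (Subset p) → Set where
    start  : Facet η → Stacked (η ∷ [])
    attach : Stacked L → Facet η → (G : Subset p) → ∣ G ∣ ≡ n → G ⊆ η → Covered L G →
             (y : Fin p) → y ∈ η → Fresh L y → Stacked (η ∷ L)

  chained-facet : Chained L → η ∈ₗ L → Facet η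
  chained-facet (start fη) (here refl) = fη
  chained-facet (extend _ fη _ _ _ _ _) (here refl) = fη
  chained-facet (extend ch _ _ _ _ _ _) (there η∈L) = chained-facet ch η∈L

  stacked-facet : Stacked L → η ∈ₗ L → Facet η
  stacked-facet (start fη) (here refl) = fη
  stacked-facet (attach _ fη _ _ _ _ _ _ _) (here refl) = fη
  stacked-facet (attach st _ _ _ _ _ _ _ _) (there η∈L) = stacked-facet st η∈L

  faces : ℕ → List (Subset p) → ℕ
  faces k L = count (λ S → (∣ S ∣ ≡ᵇ suc k) ∧ does (covered? L S))

  newFaces : ℕ → Subset p → List (Subset p) → ℕ
  newFaces k η L = count (λ S → sizedSubsetᵇ η (suc k) S ∧ not (does (covered? L S)))

  faces-∷ : ∀ k η L → faces k (η ∷ L) ≡ faces k L + newFaces k η L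
  faces-∷ k η L = trans (count-split _ (λ S → does (covered? L S)))
    (cong₂ _+_ (count-cong (λ S → old (∣ S ∣ ≡ᵇ suc k) (does (S ⊆? η)) (does (covered? L S))))
               (count-cong (λ S → new (∣ S ∣ ≡ᵇ suc k) (does (S ⊆? η)) (does (covered? L S)))))
    where
    old : ∀ a b c → (a ∧ (b ∨ c)) ∧ c ≡ a ∧ c
    old true true true = refl
    old true true false = refl
    old true false c = ∧-idem c
    old false b c = refl
    new : ∀ a b c → (a ∧ (b ∨ c)) ∧ not c ≡ (a ∧ b) ∧ not c
    new true true c = refl
    new true false true = refl
    new true false false = refl
    new false b c = refl

  faces-[_] : ∀ {η} → Facet η → ∀ k → faces k (η ∷ []) ≡ suc n C suc k
  faces-[_] {η} (_ , ∣η∣≡1+n) k = begin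
    faces k (η ∷ [])                  ≡⟨ count-cong (λ S → cong ((∣ S ∣ ≡ᵇ suc k) ∧_) (∨-identityʳ (does (S ⊆? η)))) ⟩
    count (sizedSubsetᵇ η (suc k))    ≡⟨ count-sizedSubset η (suc k) ⟩
    ∣ η ∣ C suc k                     ≡⟨ cong (_C suc k) ∣η∣≡1+n ⟩
    suc n C suc k                     ∎
    where open ≡-Reasoning

  -- Attaching along a covered ridge with a fresh apex y, the new (k+1)-faces are exactly those through y,
  -- i.e. y together with a k-subset of η - y.
  newFaces-attach : ∀ k {y} → Facet η → ∣ F ∣ ≡ n → F ⊆ η → Covered L F → y ∈ η → Fresh L y →
                    newFaces k η L ≡ n C k
  newFaces-attach {η} {F} {L} k {y} (_ , ∣η∣≡1+n) ∣F∣≡n F⊆η covF y∈η fresh =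
    sym (+-cancelˡ-≡ (n C suc k) (n C k) (newFaces k η L) (begin
      n C suc k + n C k                                      ≡⟨ +-comm (n C suc k) (n C k) ⟩
      n C k + n C suc k                                      ≡⟨ nCk+nC[k+1]≡[n+1]C[k+1] n k ⟩
      suc n C suc k                                          ≡⟨ cong (_C suc k) ∣η∣≡1+n ⟨
      ∣ η ∣ C suc k                                          ≡⟨ count-sizedSubset η (suc k) ⟨
      count (sizedSubsetᵇ η (suc k))                         ≡⟨ count-split (sizedSubsetᵇ η (suc k)) (λ S → does (covered? L S)) ⟩
      count (λ S → sizedSubsetᵇ η (suc k) S ∧ does (covered? L S)) + newFaces k η L
                                                             ≡⟨ cong (_+ newFaces k η L) (count-cong old≗η-y) ⟩
      count (sizedSubsetᵇ (η - y) (suc k)) + newFaces k η L  ≡⟨ cong (_+ newFaces k η L) (count-sizedSubset (η - y) (suc k)) ⟩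
      ∣ η - y ∣ C suc k + newFaces k η L                     ≡⟨ cong (λ i → i C suc k + newFaces k η L) ∣η-y∣≡n ⟩
      n C suc k + newFaces k η L                             ∎))
    where
    open ≡-Reasoning
    ∣η-y∣≡n : ∣ η - y ∣ ≡ n
    ∣η-y∣≡n = suc-injective (trans (x∈p⇒1+∣p-x∣≡∣p∣ y∈η) ∣η∣≡1+n)
    η-y⊆F : η - y ⊆ F
    η-y⊆F = p⊆q∧∣q∣≤∣p∣⇒q⊆p F⊆η-y (≤-reflexive (trans ∣η-y∣≡n (sym ∣F∣≡n)))
      where
      F⊆η-y : F ⊆ η - y
      F⊆η-y x∈F = x∈p∧x≢y⇒x∈p-y (F⊆η x∈F) (λ { refl → fresh⇒∉covered fresh covF x∈F })
    y∈-of-⊈η-y : ∀ {S} → S ⊆ η → ¬ S ⊆ η - y → y ∈ S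
    y∈-of-⊈η-y {S} S⊆η S⊈η-y with p⊈q⇒∃x∈p∖q S⊈η-y
    ... | x , x∈S , x∉η-y with x ≟ᶠ y
    ...   | yes refl = x∈S
    ...   | no x≢y = contradiction (x∈p∧x≢y⇒x∈p-y (S⊆η x∈S) x≢y) x∉η-y
    old≗η-y : ∀ S → sizedSubsetᵇ η (suc k) S ∧ does (covered? L S) ≡ sizedSubsetᵇ (η - y) (suc k) S
    old≗η-y S with ∣ S ∣ ≡ᵇ suc k
    ... | false = refl
    ... | true with S ⊆? η | S ⊆? (η - y)
    ...   | no _ | no _ = refl
    ...   | no S⊈η | yes S⊆η-y = ⊥-elim (S⊈η (⊆-trans S⊆η-y (p─q⊆p η ⁅ y ⁆)))
    ...   | yes _ | yes S⊆η-y = dec-true (covered? L S) (Covered-⊆ (⊆-trans S⊆η-y η-y⊆F) covF)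
    ...   | yes S⊆η | no S⊈η-y =
      dec-false (covered? L S) (λ covS → fresh⇒∉covered fresh covS (y∈-of-⊈η-y S⊆η S⊈η-y))

  newFaces-0-unfresh : VerticesCovered L η → newFaces 0 η L ≡ 0
  newFaces-0-unfresh {L = L} {η = η} covered = count-none _ vertex-covered
    where
    vertex-covered : ∀ S → sizedSubsetᵇ η 1 S ∧ not (does (covered? L S)) ≡ false
    vertex-covered S with ∣ S ∣ ≡ᵇ 1 in ∣S∣≡ᵇ1
    ... | false = refl
    ... | true with S ⊆? η
    ...   | no _ = refl
    ...   | yes S⊆η with ∣p∣≡1+k⇒Nonempty S (≡ᵇ-true⇒≡ ∣S∣≡ᵇ1)
    ...     | x , x∈S = cong not (dec-true (covered? L S) (Covered-⊆ S⊆⁅x⁆ (covered (S⊆η x∈S))))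
      where
      S⊆⁅x⁆ : S ⊆ ⁅ x ⁆
      S⊆⁅x⁆ = ⊆-reflexive (∣p∣≡1∧x∈p⇒p≡⁅x⁆ (≡ᵇ-true⇒≡ ∣S∣≡ᵇ1) x∈S)

  newFaces-pos : ∀ k → ∣ S ∣ ≡ suc k → S ⊆ η → ¬ Covered L S → 1 ≤ newFaces k η L
  newFaces-pos {S} {η} {L} k ∣S∣≡1+k S⊆η uncovered = count-pos _ S new
    where
    new : sizedSubsetᵇ η (suc k) S ∧ not (does (covered? L S)) ≡ true
    new rewrite ∣S∣≡1+k | ≡ᵇ-refl k | dec-true (S ⊆? η) S⊆η | dec-false (covered? L S) uncovered = refl

  faceTally vertexTally : ℕ → List (Subset p) → ℕ
  faceTally k L = faces k L + n * (n C k)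
  vertexTally k L = faces 0 L * (n C k) + n C suc k

  faceTally-∷ : ∀ k η L → faceTally k (η ∷ L) ≡ faceTally k L + newFaces k η L
  faceTally-∷ k η L = begin
    faces k (η ∷ L) + n * (n C k)                ≡⟨ cong (_+ n * (n C k)) (faces-∷ k η L) ⟩
    faces k L + newFaces k η L + n * (n C k)     ≡⟨ +-assoc (faces k L) _ _ ⟩
    faces k L + (newFaces k η L + n * (n C k))   ≡⟨ cong (faces k L +_) (+-comm (newFaces k η L) _) ⟩
    faces k L + (n * (n C k) + newFaces k η L)   ≡⟨ +-assoc (faces k L) _ _ ⟨
    faceTally k L + newFaces k η L               ∎
    where open ≡-Reasoning

  vertexTally-∷ : ∀ k η L → vertexTally k (η ∷ L) ≡ vertexTally k L + newFaces 0 η L * (n C k)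
  vertexTally-∷ k η L = begin
    faces 0 (η ∷ L) * (n C k) + n C suc k
      ≡⟨ cong (λ v → v * (n C k) + n C suc k) (faces-∷ 0 η L) ⟩
    (faces 0 L + newFaces 0 η L) * (n C k) + n C suc k
      ≡⟨ reorder (faces 0 L) (newFaces 0 η L) (n C k) (n C suc k) ⟩
    vertexTally k L + newFaces 0 η L * (n C k)
      ∎
    where
    open ≡-Reasoning
    reorder : ∀ a b c d → (a + b) * c + d ≡ a * c + d + b * c
    reorder = solve-∀

  faceTally-attach : ∀ k {y} → Facet η → ∣ F ∣ ≡ n → F ⊆ η → Covered L F → y ∈ η → Fresh L y →
                     faceTally k (η ∷ L) ≡ faceTally k L + n C k
  faceTally-attach {η} {F} {L} k fη ∣F∣≡n F⊆η covF y∈η fresh =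
    trans (faceTally-∷ k η L) (cong (faceTally k L +_) (newFaces-attach k fη ∣F∣≡n F⊆η covF y∈η fresh))

  vertexTally-attach : ∀ k {y} → Facet η → ∣ F ∣ ≡ n → F ⊆ η → Covered L F → y ∈ η → Fresh L y →
                       vertexTally k (η ∷ L) ≡ vertexTally k L + n C k
  vertexTally-attach {η} {F} {L} k fη ∣F∣≡n F⊆η covF y∈η fresh = begin
    vertexTally k (η ∷ L)                       ≡⟨ vertexTally-∷ k η L ⟩
    vertexTally k L + newFaces 0 η L * (n C k)
      ≡⟨ cong (λ v → vertexTally k L + v * (n C k)) (newFaces-attach 0 fη ∣F∣≡n F⊆η covF y∈η fresh) ⟩
    vertexTally k L + 1 * (n C k)               ≡⟨ cong (vertexTally k L +_) (*-identityˡ (n C k)) ⟩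
    vertexTally k L + n C k                     ∎
    where open ≡-Reasoning

  vertexTally-unfresh : ∀ k → VerticesCovered L η → vertexTally k (η ∷ L) ≡ vertexTally k L
  vertexTally-unfresh {L = L} {η = η} k covered =
    trans (vertexTally-∷ k η L) (trans (cong (λ v → vertexTally k L + v * (n C k)) (newFaces-0-unfresh covered)) (+-identityʳ _))

  stacked-tally : ∀ k → Stacked L → faceTally k L ≡ vertexTally k L
  stacked-tally k (start {η} fη) = begin
    faces k (η ∷ []) + n * (n C k)                  ≡⟨ cong (_+ n * (n C k)) (faces-[ fη ] k) ⟩
    suc n C suc k + n * (n C k)                     ≡⟨ cong (_+ n * (n C k)) (nCk+nC[k+1]≡[n+1]C[k+1] n k) ⟨
    n C k + n C suc k + n * (n C k)                 ≡⟨ reorder n (n C k) (n C suc k) ⟩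
    suc n * (n C k) + n C suc k                     ≡⟨ cong (λ v → v * (n C k) + n C suc k) vertices ⟨
    faces 0 (η ∷ []) * (n C k) + n C suc k          ∎
    where
    open ≡-Reasoning
    reorder : ∀ n a b → a + b + n * a ≡ suc n * a + b
    reorder = solve-∀
    vertices : faces 0 (η ∷ []) ≡ suc n
    vertices = trans (faces-[ fη ] 0) (nC1≡n (suc n))
  stacked-tally k (attach {L} {η} st fη G ∣G∣≡n G⊆η covG y y∈η fresh) = begin
    faceTally k (η ∷ L)        ≡⟨ faceTally-attach k fη ∣G∣≡n G⊆η covG y∈η fresh ⟩
    faceTally k L + n C k      ≡⟨ cong (_+ n C k) (stacked-tally k st) ⟩
    vertexTally k L + n C k    ≡⟨ vertexTally-attach k fη ∣G∣≡n G⊆η covG y∈η fresh ⟨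
    vertexTally k (η ∷ L)      ∎
    where open ≡-Reasoning

  Covered-attach⁻ : Facet θ → ∣ G ∣ ≡ n → G ⊆ θ → Covered L G → ∀ {y} → y ∈ θ → Fresh L y →
                    Covered (θ ∷ L) S → y ∉ S → Covered L S
  Covered-attach⁻ fθ ∣G∣≡n G⊆θ covG y∈θ fresh (here S⊆θ) y∉S =
    Covered-⊆ (λ v∈S → ∈facet∧≢apex⇒∈ridge fθ ∣G∣≡n G⊆θ y∈θ (fresh⇒∉covered fresh covG) (S⊆θ v∈S)
                                            (λ { refl → y∉S v∈S }))
              covG
  Covered-attach⁻ _ _ _ _ _ _ (there covS) _ = covS

  fresh? : ∀ η L → Dec (∃ λ y → y ∈ η × Fresh L y)
  fresh? η L = anyFin? (λ y → (y ∈? η) ×-dec ¬? (covered? L ⁅ y ⁆))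

  ¬fresh⇒verticesCovered : ¬ (∃ λ y → y ∈ η × Fresh L y) → VerticesCovered L η
  ¬fresh⇒verticesCovered {η = η} {L = L} noFresh {y} y∈η with covered? L ⁅ y ⁆
  ... | yes cov = cov
  ... | no uncov = ⊥-elim (noFresh (y , y∈η , uncov))

  -- If η misses the apex y of the last facet θ, recurse; otherwise every face of η through y and
  -- through a vertex outside θ is new.
  stacked-uncoveredFace : Stacked L → Facet η → ¬ η ∈ₗ L → VerticesCovered L η →
                          ∀ k → 1 ≤ k → k ≤ n → ∃ λ S → ∣ S ∣ ≡ suc k × S ⊆ η × ¬ Covered L S
  stacked-uncoveredFace {η = η} (start {θ} fθ) fη η∉ covered k _ _ = ⊥-elim (η∉ (here (facet-⊆⇒≡ fη fθ η⊆θ)))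
    where
    η⊆θ : η ⊆ θ
    η⊆θ v∈η with covered v∈η
    ... | here ⁅v⁆⊆θ = ⁅v⁆⊆θ (x∈⁅x⁆ _)
  stacked-uncoveredFace {η = η} (attach {L} {θ} st fθ G ∣G∣≡n G⊆θ covG y y∈θ fresh) fη η∉ covered k 1≤k k≤n
    with y ∈? η
  ... | no y∉η with stacked-uncoveredFace st fη (η∉ ∘ there) (λ {v} v∈η → drop (covered v∈η) (y∉⁅v⁆ v∈η)) k 1≤k k≤n
    where
    drop : ∀ {S} → Covered (θ ∷ L) S → y ∉ S → Covered L S
    drop = Covered-attach⁻ fθ ∣G∣≡n G⊆θ covG y∈θ fresh
    y∉⁅v⁆ : ∀ {v} → v ∈ η → y ∉ ⁅ v ⁆
    y∉⁅v⁆ {v} v∈η y∈⁅v⁆ = y∉η (subst (_∈ η) (sym (x∈⁅y⁆⇒x≡y v y∈⁅v⁆)) v∈η)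
  ...   | S , ∣S∣≡1+k , S⊆η , uncov =
    S , ∣S∣≡1+k , S⊆η , λ covS → uncov (Covered-attach⁻ fθ ∣G∣≡n G⊆θ covG y∈θ fresh covS (y∉η ∘ S⊆η))
  stacked-uncoveredFace {η = η} (attach {L} {θ} st fθ G ∣G∣≡n G⊆θ covG y y∈θ fresh) fη@(_ , ∣η∣≡1+n) η∉ covered k 1≤k k≤n
    | yes y∈η with p⊈q⇒∃x∈p∖q (λ η⊆θ → η∉ (here (facet-⊆⇒≡ fη fθ η⊆θ)))
  ... | z , z∈η , z∉θ with ⊆-interpolate (⁅ y ⁆ ∪ ⁅ z ⁆) η (suc k) (⁅x⁆∪⁅y⁆⊆p y∈η z∈η)
                             (≤-trans (∣⁅x⁆∪⁅y⁆∣≤2 y z) (s≤s 1≤k)) (≤-trans (s≤s k≤n) (≤-reflexive (sym ∣η∣≡1+n)))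
  ...   | S , yz⊆S , S⊆η , ∣S∣≡1+k = S , ∣S∣≡1+k , S⊆η , uncovered
    where
    uncovered : ¬ Covered (θ ∷ L) S
    uncovered (here S⊆θ) = z∉θ (S⊆θ (yz⊆S (x∈p∪q⁺ (inj₂ (x∈⁅x⁆ z)))))
    uncovered (there covS) = fresh⇒∉covered fresh covS (yz⊆S (x∈p∪q⁺ (inj₁ (x∈⁅x⁆ y))))

  chained⇒stacked⊎tally< : ∀ k → 1 ≤ k → k ≤ n → Chained L → Stacked L ⊎ vertexTally k L < faceTally k L
  chained⇒stacked⊎tally< k _ _ (start fη) = inj₁ (start fη)
  chained⇒stacked⊎tally< k 1≤k k≤n (extend {L} {η} ch fη η∉ F ∣F∣≡n F⊆η covF)
    with chained⇒stacked⊎tally< k 1≤k k≤n ch | fresh? η L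
  ... | inj₁ st | yes (y , y∈η , fresh) = inj₁ (attach st fη F ∣F∣≡n F⊆η covF y y∈η fresh)
  ... | inj₂ tally< | yes (y , y∈η , fresh) =
    inj₂ (subst₂ _<_ (sym (vertexTally-attach k fη ∣F∣≡n F⊆η covF y∈η fresh))
                     (sym (faceTally-attach k fη ∣F∣≡n F⊆η covF y∈η fresh))
                     (+-monoˡ-< (n C k) tally<))
  ... | inj₁ st | no noFresh =
    let S , ∣S∣≡1+k , S⊆η , uncov = stacked-uncoveredFace st fη η∉ (¬fresh⇒verticesCovered noFresh) k 1≤k k≤n
    in inj₂ (subst₂ _<_ (sym (vertexTally-unfresh k (¬fresh⇒verticesCovered noFresh)))
                        (sym (faceTally-∷ k η L))
                        (subst (_< faceTally k L + newFaces k η L) (stacked-tally k st)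
                               (m<m+n (faceTally k L) (newFaces-pos k ∣S∣≡1+k S⊆η uncov))))
  ... | inj₂ tally< | no noFresh =
    inj₂ (subst₂ _<_ (sym (vertexTally-unfresh k (¬fresh⇒verticesCovered noFresh)))
                     (sym (faceTally-∷ k η L))
                     (≤-trans tally< (m≤m+n (faceTally k L) (newFaces k η L))))

  SharedFacet : List (Subset p) → Subset p → Subset p → Set
  SharedFacet L F T = ∃ λ ξ → ξ ∈ₗ L × F ⊆ ξ × T ⊆ ξ

  -- Facets facet 0, …, facet steps of L, consecutive ones meeting in a ridge, from the ridge F to the
  -- first facet containing T; pivot i leaves the gallery for good after facet i.
  record Gallery (L : List (Subset p)) (F T : Subset p) : Set where
    field
      steps : ℕ
      pivot : ℕ → Fin p
      ridge facet : ℕ → Subset p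
      ridge-start : ridge 0 ≡ F
      ridge-size : ∀ i → i ≤ steps → ∣ ridge i ∣ ≡ n
      ridge⊆facet : ∀ i → i ≤ steps → ridge i ⊆ facet i
      ridge⊆facet-before : ∀ i → suc i ≤ steps → ridge (suc i) ⊆ facet i
      pivot∈ridge : ∀ i → i ≤ steps → pivot i ∈ ridge i
      pivot∉later : ∀ i j → i < j → j ≤ steps → pivot i ∉ facet j
      target⊆last : T ⊆ facet steps
      target⊈earlier : ∀ j → j < steps → ¬ T ⊆ facet j
      lastPivot∉target : pivot steps ∉ T
      ridges-distinct : ∀ i j → i < j → j ≤ steps → ridge i ≢ ridge j
      facets-distinct : ∀ i j → i < j → j ≤ steps → facet i ≢ facet j
      facet∈ : ∀ i → i ≤ steps → facet i ∈ₗ L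

  open Gallery

  Linked : List (Subset p) → Subset p → Subset p → Set
  Linked L F T = SharedFacet L F T ⊎ Gallery L F T

  gallery-[_] : ∀ {ξ R T τ} → ξ ∈ₗ L → ∣ R ∣ ≡ n → R ⊆ ξ → τ ∈ R → T ⊆ ξ → τ ∉ T → Gallery L R T
  gallery-[_] {ξ = ξ} {R} {τ = τ} ξ∈L ∣R∣≡n R⊆ξ τ∈R T⊆ξ τ∉T = record
    { steps = 0 ; pivot = λ _ → τ ; ridge = λ _ → R ; facet = λ _ → ξ
    ; ridge-start = refl
    ; ridge-size = λ _ _ → ∣R∣≡n
    ; ridge⊆facet = λ _ _ → R⊆ξ
    ; ridge⊆facet-before = λ _ ()
    ; pivot∈ridge = λ _ _ → τ∈R
    ; pivot∉later = λ { _ zero () _ ; _ (suc _) _ () }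
    ; target⊆last = T⊆ξ
    ; target⊈earlier = λ _ ()
    ; lastPivot∉target = τ∉T
    ; ridges-distinct = λ { _ zero () _ ; _ (suc _) _ () }
    ; facets-distinct = λ { _ zero () _ ; _ (suc _) _ () }
    ; facet∈ = λ _ _ → ξ∈L
    }

  Gallery-there : Gallery L F T → Gallery (θ ∷ L) F T
  Gallery-there g = record
    { steps = steps g ; pivot = pivot g ; ridge = ridge g ; facet = facet g
    ; ridge-start = ridge-start g ; ridge-size = ridge-size g ; ridge⊆facet = ridge⊆facet g
    ; ridge⊆facet-before = ridge⊆facet-before g ; pivot∈ridge = pivot∈ridge g ; pivot∉later = pivot∉later g
    ; target⊆last = target⊆last g ; target⊈earlier = target⊈earlier g ; lastPivot∉target = lastPivot∉target g
    ; ridges-distinct = ridges-distinct g ; facets-distinct = facets-distinct g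
    ; facet∈ = λ i i≤ → there (facet∈ g i i≤)
    }

  gallery-∷ : ∀ {y} → θ ∈ₗ L → (g : Gallery L G T) → ∣ F ∣ ≡ n → F ⊆ θ → G ⊆ θ → y ∈ F →
              (∀ j → j ≤ steps g → y ∉ facet g j) → ¬ T ⊆ θ →
              (∀ j → j ≤ steps g → ridge g j ≢ F) → (∀ j → j ≤ steps g → facet g j ≢ θ) → Gallery L F T
  gallery-∷ {θ} {G = G} {F = F} {y} θ∈L g ∣F∣≡n F⊆θ G⊆θ y∈F y∉later T⊈θ ridge≢F facet≢θ = record
    { steps = suc (steps g) ; pivot = y ∷ˢ pivot g ; ridge = F ∷ˢ ridge g ; facet = θ ∷ˢ facet g
    ; ridge-start = refl
    ; ridge-size = λ { zero _ → ∣F∣≡n ; (suc i) (s≤s i≤) → ridge-size g i i≤ }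
    ; ridge⊆facet = λ { zero _ → F⊆θ ; (suc i) (s≤s i≤) → ridge⊆facet g i i≤ }
    ; ridge⊆facet-before = λ { zero _ → subst (_⊆ θ) (sym (ridge-start g)) G⊆θ ; (suc i) (s≤s i<) → ridge⊆facet-before g i i< }
    ; pivot∈ridge = λ { zero _ → y∈F ; (suc i) (s≤s i≤) → pivot∈ridge g i i≤ }
    ; pivot∉later = λ { zero (suc j) _ (s≤s j≤) → y∉later j j≤
                      ; (suc i) (suc j) (s≤s i<j) (s≤s j≤) → pivot∉later g i j i<j j≤ }
    ; target⊆last = target⊆last g
    ; target⊈earlier = λ { zero _ → T⊈θ ; (suc j) (s≤s j<) → target⊈earlier g j j< }
    ; lastPivot∉target = lastPivot∉target g
    ; ridges-distinct = λ { zero (suc j) _ (s≤s j≤) → ridge≢F j j≤ ∘ sym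
                          ; (suc i) (suc j) (s≤s i<j) (s≤s j≤) → ridges-distinct g i j i<j j≤ }
    ; facets-distinct = λ { zero (suc j) _ (s≤s j≤) → facet≢θ j j≤ ∘ sym
                          ; (suc i) (suc j) (s≤s i<j) (s≤s j≤) → facets-distinct g i j i<j j≤ }
    ; facet∈ = λ { zero _ → θ∈L ; (suc i) (s≤s i≤) → facet∈ g i i≤ }
    }

  gallery-∷ʳ : ∀ {g} → θ ∈ₗ L → (c : Gallery L F G) → ∣ G ∣ ≡ n → G ⊆ θ → g ∈ G → g ∉ T → T ⊆ θ →
               (∀ j → j ≤ steps c → ¬ T ⊆ facet c j) → (∀ i → i ≤ steps c → pivot c i ∉ θ) →
               (∀ i → i ≤ steps c → ridge c i ≢ G) → (∀ j → j ≤ steps c → facet c j ≢ θ) → Gallery L F T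
  gallery-∷ʳ {θ} {L} {F} {G} {T} {g} θ∈L c ∣G∣≡n G⊆θ g∈G g∉T T⊆θ T⊈facets pivots∉θ ridge≢G facet≢θ = record
    { steps = M ; pivot = extendAt M g (pivot c) ; ridge = extendAt M G (ridge c) ; facet = extendAt M θ (facet c)
    ; ridge-start = trans (extendAt-< M G (ridge c) (s≤s z≤n)) (ridge-start c)
    ; ridge-size = λ i i≤M → by-cases i≤M
        (λ i≤ → trans (cong ∣_∣ (old ridge G i≤)) (ridge-size c i i≤))
        (λ { refl → trans (cong ∣_∣ (extendAt-≡ M G (ridge c))) ∣G∣≡n })
    ; ridge⊆facet = λ i i≤M → by-cases i≤M
        (λ i≤ → subst₂ _⊆_ (sym (old ridge G i≤)) (sym (old facet θ i≤)) (ridge⊆facet c i i≤))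
        (λ { refl → subst₂ _⊆_ (sym (extendAt-≡ M G (ridge c))) (sym (extendAt-≡ M θ (facet c))) G⊆θ })
    ; ridge⊆facet-before = λ i 1+i≤M → by-cases 1+i≤M
        (λ 1+i≤ → subst₂ _⊆_ (sym (old ridge G 1+i≤)) (sym (old facet θ (≤-trans (n≤1+n i) 1+i≤)))
                             (ridge⊆facet-before c i 1+i≤))
        (λ { refl → subst₂ _⊆_ (sym (extendAt-≡ M G (ridge c))) (sym (old facet θ ≤-refl)) (target⊆last c) })
    ; pivot∈ridge = λ i i≤M → by-cases i≤M
        (λ i≤ → subst₂ _∈_ (sym (old pivot g i≤)) (sym (old ridge G i≤)) (pivot∈ridge c i i≤))
        (λ { refl → subst₂ _∈_ (sym (extendAt-≡ M g (pivot c))) (sym (extendAt-≡ M G (ridge c))) g∈G })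
    ; pivot∉later = λ i j i<j j≤M → by-cases j≤M
        (λ j≤ → subst₂ _∉_ (sym (old pivot g (≤-trans (n≤1+n i) (≤-trans i<j j≤)))) (sym (old facet θ j≤))
                           (pivot∉later c i j i<j j≤))
        (λ { refl → subst₂ _∉_ (sym (old pivot g (≤-pred i<j))) (sym (extendAt-≡ M θ (facet c)))
                               (pivots∉θ i (≤-pred i<j)) })
    ; target⊆last = subst (T ⊆_) (sym (extendAt-≡ M θ (facet c))) T⊆θ
    ; target⊈earlier = λ j j<M → subst (λ ζ → ¬ T ⊆ ζ) (sym (old facet θ (≤-pred j<M))) (T⊈facets j (≤-pred j<M))
    ; lastPivot∉target = subst (_∉ T) (sym (extendAt-≡ M g (pivot c))) g∉T
    ; ridges-distinct = λ i j i<j j≤M → by-cases j≤M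
        (λ j≤ → subst₂ _≢_ (sym (old ridge G (≤-trans (n≤1+n i) (≤-trans i<j j≤)))) (sym (old ridge G j≤))
                           (ridges-distinct c i j i<j j≤))
        (λ { refl → subst₂ _≢_ (sym (old ridge G (≤-pred i<j))) (sym (extendAt-≡ M G (ridge c)))
                               (ridge≢G i (≤-pred i<j)) })
    ; facets-distinct = λ i j i<j j≤M → by-cases j≤M
        (λ j≤ → subst₂ _≢_ (sym (old facet θ (≤-trans (n≤1+n i) (≤-trans i<j j≤)))) (sym (old facet θ j≤))
                           (facets-distinct c i j i<j j≤))
        (λ { refl → subst₂ _≢_ (sym (old facet θ (≤-pred i<j))) (sym (extendAt-≡ M θ (facet c)))
                               (facet≢θ i (≤-pred i<j)) })
    ; facet∈ = λ i i≤M → by-cases i≤M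
        (λ i≤ → subst (_∈ₗ L) (sym (old facet θ i≤)) (facet∈ c i i≤))
        (λ { refl → subst (_∈ₗ L) (sym (extendAt-≡ M θ (facet c))) θ∈L })
    }
    where
    M : ℕ
    M = suc (steps c)
    old : ∀ {X : Set} (f : Gallery L F G → ℕ → X) x {i} → i ≤ steps c → extendAt M x (f c) i ≡ f c i
    old f x i≤ = extendAt-< M x (f c) (s≤s i≤)
    by-cases : ∀ {B : Set} {i} → i ≤ M → (i ≤ steps c → B) → (i ≡ M → B) → B
    by-cases i≤M old-index new-index with m≤n⇒m<n∨m≡n i≤M
    ... | inj₁ (s≤s i≤) = old-index i≤
    ... | inj₂ i≡M = new-index i≡M

  module AttachStep {L θ G y} (fθ : Facet θ) (∣G∣≡n : ∣ G ∣ ≡ n) (G⊆θ : G ⊆ θ) (covG : Covered L G)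
                    (y∈θ : y ∈ θ) (fresh : Fresh L y)
                    (linked : ∀ {F T} → ∣ F ∣ ≡ n → Covered L F → ∣ T ∣ ≤ n → Covered L T → Linked L F T) where

    y∉G : y ∉ G
    y∉G = fresh⇒∉covered fresh covG

    y∉old : ∀ {ζ} → ζ ∈ₗ L → y ∉ ζ
    y∉old ζ∈L = fresh⇒∉covered fresh (lose ζ∈L ⊆-refl)

    drop : Covered (θ ∷ L) S → y ∉ S → Covered L S
    drop = Covered-attach⁻ fθ ∣G∣≡n G⊆θ covG y∈θ fresh

    apex⇒⊆θ : Covered (θ ∷ L) S → y ∈ S → S ⊆ θ
    apex⇒⊆θ (here S⊆θ) _ = S⊆θ
    apex⇒⊆θ (there covS) y∈S = ⊥-elim (fresh⇒∉covered fresh covS y∈S)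

    -- G spans all of θ except y, so a set of size ≤ n containing y cannot contain G.
    ∃G∖T : ∀ {T} → ∣ T ∣ ≤ n → y ∈ T → ∃ λ g → g ∈ G × g ∉ T
    ∃G∖T ∣T∣≤n y∈T = p⊈q⇒∃x∈p∖q (λ G⊆T → <⇒≱ (p⊂q⇒∣p∣<∣q∣ (G⊆T , _ , y∈T , y∉G)) (≤-trans ∣T∣≤n (≤-reflexive (sym ∣G∣≡n))))

    linked-apex∈target : ∀ {F T} → ∣ F ∣ ≡ n → Covered (θ ∷ L) F → ∣ T ∣ ≤ n → y ∈ T → T ⊆ θ → Linked (θ ∷ L) F T
    linked-apex∈target {F} {T} ∣F∣≡n covF ∣T∣≤n y∈T T⊆θ with F ⊆? θ
    ... | yes F⊆θ = inj₁ (θ , here refl , F⊆θ , T⊆θ)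
    ... | no F⊈θ with linked ∣F∣≡n (drop covF λ y∈F → F⊈θ (apex⇒⊆θ covF y∈F)) (≤-reflexive ∣G∣≡n) covG | ∃G∖T ∣T∣≤n y∈T
    ...   | inj₁ (ξ , ξ∈L , F⊆ξ , G⊆ξ) | g , g∈G , g∉T =
      let f , f∈F , f∉θ = p⊈q⇒∃x∈p∖q F⊈θ in
      inj₂ (gallery-∷ (there ξ∈L) (gallery-[ here refl ] ∣G∣≡n G⊆θ g∈G T⊆θ g∉T) ∣F∣≡n F⊆ξ G⊆ξ f∈F
                      (λ { zero _ → f∉θ }) (λ T⊆ξ → y∉old ξ∈L (T⊆ξ y∈T))
                      (λ { zero _ G≡F → F⊈θ (subst (_⊆ θ) G≡F G⊆θ) })
                      (λ { zero _ θ≡ξ → y∉old ξ∈L (subst (y ∈_) θ≡ξ y∈θ) }))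
    ...   | inj₂ c | g , g∈G , g∉T =
      inj₂ (gallery-∷ʳ (here refl) (Gallery-there c) ∣G∣≡n G⊆θ g∈G g∉T T⊆θ
                       (λ j j≤ T⊆ → y∉old (facet∈ c j j≤) (T⊆ y∈T)) pivots∉θ ridge≢G
                       (λ j j≤ ζ≡θ → y∉old (facet∈ c j j≤) (subst (y ∈_) (sym ζ≡θ) y∈θ)))
      where
      pivot∈G : ∀ {i} → i ≤ steps c → pivot c i ∈ θ → pivot c i ∈ G
      pivot∈G {i} i≤ pivot∈θ = ∈facet∧≢apex⇒∈ridge fθ ∣G∣≡n G⊆θ y∈θ y∉G pivot∈θ
        (λ pivot≡y → y∉old (facet∈ c i i≤) (subst (_∈ facet c i) pivot≡y (ridge⊆facet c i i≤ (pivot∈ridge c i i≤))))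
      pivots∉θ : ∀ i → i ≤ steps c → pivot c i ∉ θ
      pivots∉θ i i≤ pivot∈θ with i <? steps c
      ... | yes i< = pivot∉later c i (steps c) i< ≤-refl (target⊆last c (pivot∈G i≤ pivot∈θ))
      ... | no i≮ = lastPivot∉target c (subst (λ j → pivot c j ∈ G) (≤-antisym i≤ (≮⇒≥ i≮)) (pivot∈G i≤ pivot∈θ))
      ridge≢G : ∀ i → i ≤ steps c → ridge c i ≢ G
      ridge≢G zero _ F≡G = F⊈θ (subst (_⊆ θ) (trans (sym F≡G) (ridge-start c)) G⊆θ)
      ridge≢G (suc i) i< ρ≡G = target⊈earlier c i i< (subst (_⊆ facet c i) ρ≡G (ridge⊆facet-before c i i<))

    linked-apex∉target : ∀ {F T} → ∣ F ∣ ≡ n → Covered (θ ∷ L) F → ∣ T ∣ ≤ n → Covered L T → Linked (θ ∷ L) F T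
    linked-apex∉target {F} {T} ∣F∣≡n covF ∣T∣≤n covT with y ∈? F
    ... | no y∉F with linked ∣F∣≡n (drop covF y∉F) ∣T∣≤n covT
    ...   | inj₁ (ξ , ξ∈L , F⊆ξ , T⊆ξ) = inj₁ (ξ , there ξ∈L , F⊆ξ , T⊆ξ)
    ...   | inj₂ c = inj₂ (Gallery-there c)
    linked-apex∉target {F} {T} ∣F∣≡n covF ∣T∣≤n covT | yes y∈F with T ⊆? θ
    ... | yes T⊆θ = inj₁ (θ , here refl , apex⇒⊆θ covF y∈F , T⊆θ)
    ... | no T⊈θ with linked ∣G∣≡n covG ∣T∣≤n covT
    ...   | inj₁ (ξ , ξ∈L , G⊆ξ , T⊆ξ) =
      let g , g∈G , g∉T = p⊈q⇒∃x∈p∖q λ G⊆T →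
                            T⊈θ (⊆-trans (p⊆q∧∣q∣≤∣p∣⇒q⊆p G⊆T (≤-trans ∣T∣≤n (≤-reflexive (sym ∣G∣≡n)))) G⊆θ) in
      inj₂ (gallery-∷ (here refl) (gallery-[ there ξ∈L ] ∣G∣≡n G⊆ξ g∈G T⊆ξ g∉T) ∣F∣≡n (apex⇒⊆θ covF y∈F) G⊆θ y∈F
                      (λ { zero _ → y∉old ξ∈L }) T⊈θ
                      (λ { zero _ G≡F → y∉G (subst (y ∈_) (sym G≡F) y∈F) })
                      (λ { zero _ ξ≡θ → y∉old ξ∈L (subst (y ∈_) (sym ξ≡θ) y∈θ) }))
    ...   | inj₂ c =
      inj₂ (gallery-∷ (here refl) (Gallery-there c) ∣F∣≡n (apex⇒⊆θ covF y∈F) G⊆θ y∈F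
                      (λ j j≤ → y∉old (facet∈ c j j≤)) T⊈θ
                      (λ j j≤ ρ≡F → y∉old (facet∈ c j j≤) (ridge⊆facet c j j≤ (subst (y ∈_) (sym ρ≡F) y∈F)))
                      (λ j j≤ ζ≡θ → y∉old (facet∈ c j j≤) (subst (y ∈_) (sym ζ≡θ) y∈θ)))

    linked-attach : ∀ {F T} → ∣ F ∣ ≡ n → Covered (θ ∷ L) F → ∣ T ∣ ≤ n → Covered (θ ∷ L) T → Linked (θ ∷ L) F T
    linked-attach {T = T} ∣F∣≡n covF ∣T∣≤n covT with y ∈? T
    ... | yes y∈T = linked-apex∈target ∣F∣≡n covF ∣T∣≤n y∈T (apex⇒⊆θ covT y∈T)
    ... | no y∉T = linked-apex∉target ∣F∣≡n covF ∣T∣≤n (drop covT y∉T)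

  stacked-linked : Stacked L → ∣ F ∣ ≡ n → Covered L F → ∣ T ∣ ≤ n → Covered L T → Linked L F T
  stacked-linked (start {θ} _) _ (here F⊆θ) _ (here T⊆θ) = inj₁ (θ , here refl , F⊆θ , T⊆θ)
  stacked-linked (attach st fθ G ∣G∣≡n G⊆θ covG y y∈θ fresh) =
    AttachStep.linked-attach fθ ∣G∣≡n G⊆θ covG y∈θ fresh (stacked-linked st)

  ridge⊆∧apex∈⇒facet⊆ : ∀ {ξ x} → Facet η → ∣ F ∣ ≡ n → F ⊆ η → x ∈ η → x ∉ F → F ⊆ ξ → x ∈ ξ → η ⊆ ξ
  ridge⊆∧apex∈⇒facet⊆ {x = x} fη ∣F∣≡n F⊆η x∈η x∉F F⊆ξ x∈ξ {v} v∈η with v ≟ᶠ x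
  ... | yes refl = x∈ξ
  ... | no v≢x = F⊆ξ (∈facet∧≢apex⇒∈ridge fη ∣F∣≡n F⊆η x∈η x∉F v∈η v≢x)

  ridge-simplex : 1 ≤ n → ∣ S ∣ ≡ n → S ⊆ ζ → Facet ζ → IsSimplex K (n ∸ 1) S
  ridge-simplex {S} 1≤n ∣S∣≡n S⊆ζ (ζ∈K , _) =
    closed K S _ ζ∈K (∣p∣≡1+k⇒Nonempty S ∣S∣≡1+[n∸1]) S⊆ζ , ∣S∣≡1+[n∸1]
    where
    ∣S∣≡1+[n∸1] : ∣ S ∣ ≡ suc (n ∸ 1)
    ∣S∣≡1+[n∸1] = trans ∣S∣≡n (sym (m+[n∸m]≡n 1≤n))

  -- The cycle ⁅x⁆, η, ⁅pivot 0⁆, facet 0, …, ⁅pivot steps⁆, facet steps, ⁅x⁆, with the ridges of the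
  -- gallery as the (n-1)-simplices σ′. Sequences are 1-indexed as in IsCycle; index 0 is unused.
  module GalleryCycle {L η F x} (1≤n : 1 ≤ n) (st : Stacked L) (fη : Facet η) (η∉L : ¬ η ∈ₗ L) (F⊆η : F ⊆ η)
                      (x∈η : x ∈ η) (x∉F : x ∉ F) (c : Gallery L F ⁅ x ⁆) (1≤steps : 1 ≤ steps c) where

    M r : ℕ
    M = steps c
    r = suc (suc M)

    pivot′ : ℕ → Fin p
    pivot′ = extendAt (suc M) x (pivot c)

    vertex : ℕ → Fin p
    vertex zero = x
    vertex (suc zero) = x
    vertex (suc (suc i)) = pivot′ i

    σ ηs σ′ : ℕ → Subset p
    σ k = ⁅ vertex k ⁆
    ηs zero = η
    ηs (suc zero) = η
    ηs (suc (suc i)) = facet c i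
    σ′ zero = F
    σ′ (suc zero) = F
    σ′ (suc (suc i)) = ridge c i

    pivot′-< : ∀ {i} → i ≤ M → pivot′ i ≡ pivot c i
    pivot′-< i≤ = extendAt-< (suc M) x (pivot c) (s≤s i≤)

    pivot′-last : pivot′ (suc M) ≡ x
    pivot′-last = extendAt-≡ (suc M) x (pivot c)

    pivot∈facet : ∀ i → i ≤ M → pivot c i ∈ facet c i
    pivot∈facet i i≤ = ridge⊆facet c i i≤ (pivot∈ridge c i i≤)

    pivot0∈F : pivot c 0 ∈ F
    pivot0∈F = subst (pivot c 0 ∈_) (ridge-start c) (pivot∈ridge c 0 z≤n)

    x∈last : x ∈ facet c M
    x∈last = target⊆last c (x∈⁅x⁆ x)

    x∉earlier : ∀ j → j < M → x ∉ facet c j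
    x∉earlier j j< x∈ = target⊈earlier c j j< (x∈p⇒⁅x⁆⊆p x∈)

    pivot≢x : ∀ j → j ≤ M → pivot c j ≢ x
    pivot≢x j j≤ pivot≡x with j <? M
    ... | yes j< = x∉earlier j j< (subst (_∈ facet c j) pivot≡x (pivot∈facet j j≤))
    ... | no j≮ = lastPivot∉target c (subst (λ i → pivot c i ∈ ⁅ x ⁆) (≤-antisym j≤ (≮⇒≥ j≮))
                                             (subst (_∈ ⁅ x ⁆) (sym pivot≡x) (x∈⁅x⁆ x)))

    walk : ∀ k → 1 ≤ k → k ≤ r → (σ k ≢ σ (suc k)) × (σ k ⊆ ηs k) × (σ (suc k) ⊆ ηs k)
    walk (suc zero) _ _ =
      (λ x≡pivot → x∉F (subst (_∈ F) (trans (sym (pivot′-< z≤n)) (sym (⁅⁆-injective x≡pivot))) pivot0∈F)) ,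
      x∈p⇒⁅x⁆⊆p x∈η ,
      x∈p⇒⁅x⁆⊆p (subst (_∈ η) (sym (pivot′-< z≤n)) (F⊆η pivot0∈F))
    walk (suc (suc i)) _ (s≤s (s≤s i≤)) with suc i ≤? M
    ... | yes 1+i≤ =
      (λ eq → pivot∉later c i (suc i) ≤-refl 1+i≤
                (subst (_∈ facet c (suc i)) (trans (sym (pivot′-< 1+i≤)) (trans (sym (⁅⁆-injective eq)) (pivot′-< i≤)))
                       (pivot∈facet (suc i) 1+i≤))) ,
      x∈p⇒⁅x⁆⊆p (subst (_∈ facet c i) (sym (pivot′-< i≤)) (pivot∈facet i i≤)) ,
      x∈p⇒⁅x⁆⊆p (subst (_∈ facet c i) (sym (pivot′-< 1+i≤)) (ridge⊆facet-before c i 1+i≤ (pivot∈ridge c (suc i) 1+i≤)))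
    ... | no 1+i≰ =
      (λ eq → pivot≢x i i≤ (trans (sym (pivot′-< i≤)) (trans (⁅⁆-injective eq) (trans (cong pivot′ (cong suc i≡M)) pivot′-last)))) ,
      x∈p⇒⁅x⁆⊆p (subst (_∈ facet c i) (sym (pivot′-< i≤)) (pivot∈facet i i≤)) ,
      x∈p⇒⁅x⁆⊆p (subst (_∈ facet c i) (sym (trans (cong pivot′ (cong suc i≡M)) pivot′-last))
                        (subst (λ j → x ∈ facet c j) (sym i≡M) x∈last))
      where
      i≡M : i ≡ M
      i≡M = ≤-antisym i≤ (≤-pred (≰⇒> 1+i≰))

    vertices-distinct : ∀ i j → 1 ≤ i → i < j → j ≤ r → vertex i ≢ vertex j
    vertices-distinct (suc zero) (suc (suc j)) _ _ (s≤s (s≤s j≤)) x≡ = pivot≢x j j≤ (trans (sym (pivot′-< j≤)) (sym x≡))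
    vertices-distinct (suc (suc i)) (suc (suc j)) _ (s≤s (s≤s i<j)) (s≤s (s≤s j≤)) eq =
      pivot∉later c i j i<j j≤
        (subst (_∈ facet c j) (trans (sym (pivot′-< j≤)) (trans (sym eq) (pivot′-< (≤-trans (n≤1+n i) (≤-trans i<j j≤)))))
               (pivot∈facet j j≤))

    vertices-distinct (suc zero) (suc zero) _ (s≤s ()) _

    ηs-distinct : ∀ i j → 1 ≤ i → i < j → j ≤ r → ηs i ≢ ηs j
    ηs-distinct (suc zero) (suc (suc j)) _ _ (s≤s (s≤s j≤)) η≡ = η∉L (subst (_∈ₗ L) (sym η≡) (facet∈ c j j≤))
    ηs-distinct (suc (suc i)) (suc (suc j)) _ (s≤s (s≤s i<j)) (s≤s (s≤s j≤)) = facets-distinct c i j i<j j≤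

    ηs-distinct (suc zero) (suc zero) _ (s≤s ()) _

    x∉middle : ∀ k → 2 ≤ k → k ≤ r ∸ 1 → ¬ σ 1 ⊆ ηs k
    x∉middle (suc (suc i)) _ (s≤s i<) x⊆ = x∉earlier i i< (x⊆ (x∈⁅x⁆ x))
    x∉middle (suc zero) (s≤s ()) _

    ridges : ∀ z → 2 ≤ z → z ≤ r →
             IsSimplex K (n ∸ 1) (σ′ z) × (σ′ z ⊆ ηs z) × (σ′ z ⊆ ηs (z ∸ 1)) × (σ z ⊆ σ′ z)
    ridges (suc (suc i)) _ (s≤s (s≤s i≤)) =
      ridge-simplex 1≤n (ridge-size c i i≤) (ridge⊆facet c i i≤) (stacked-facet st (facet∈ c i i≤)) ,
      ridge⊆facet c i i≤ , ridge⊆previous i i≤ ,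
      x∈p⇒⁅x⁆⊆p (subst (_∈ ridge c i) (sym (pivot′-< i≤)) (pivot∈ridge c i i≤))
      where
      ridge⊆previous : ∀ i → i ≤ M → ridge c i ⊆ ηs (suc i)
      ridge⊆previous zero _ = subst (_⊆ η) (sym (ridge-start c)) F⊆η
      ridge⊆previous (suc i) 1+i≤ = ridge⊆facet-before c i 1+i≤
    ridges (suc zero) (s≤s ()) _

    σ′-distinct : ∀ i j → 2 ≤ i → i < j → j ≤ r → σ′ i ≢ σ′ j
    σ′-distinct (suc (suc i)) (suc (suc j)) _ (s≤s (s≤s i<j)) (s≤s (s≤s j≤)) = ridges-distinct c i j i<j j≤
    σ′-distinct (suc zero) _ (s≤s ()) _ _
    σ′-distinct (suc (suc i)) (suc zero) _ (s≤s ()) _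

    cycle : IsCycle K 0 n
    cycle =
      r , σ , ηs ,
      ( (λ k _ _ → singletons K (vertex k) , ∣⁅x⁆∣≡1 (vertex k))
      , (λ { (suc zero) _ _ → fη ; (suc (suc i)) _ (s≤s (s≤s i≤)) → stacked-facet st (facet∈ c i i≤) })
      , walk ) ,
      cong ⁅_⁆ pivot′-last ,
      (λ i j 1≤i i≤ 1≤j j≤ i≢j → distinct-by-< vertex vertices-distinct i j 1≤i i≤ 1≤j j≤ i≢j ∘ ⁅⁆-injective) ,
      distinct-by-< ηs ηs-distinct ,
      s≤s (s≤s 1≤steps) ,
      x∉middle ,
      σ′ , ridges , distinct-by-< σ′ σ′-distinct

  ¬sharedFacet : Stacked L → Facet η → ¬ η ∈ₗ L → ∣ F ∣ ≡ n → F ⊆ η → ∀ {x} → x ∈ η → x ∉ F → ¬ SharedFacet L F ⁅ x ⁆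
  ¬sharedFacet {L} {η} st fη η∉L ∣F∣≡n F⊆η x∈η x∉F (ξ , ξ∈L , F⊆ξ , x⊆ξ) =
    η∉L (subst (_∈ₗ L) (sym (facet-⊆⇒≡ fη (stacked-facet st ξ∈L) η⊆ξ)) ξ∈L)
    where
    η⊆ξ : η ⊆ ξ
    η⊆ξ = ridge⊆∧apex∈⇒facet⊆ fη ∣F∣≡n F⊆η x∈η x∉F F⊆ξ (x⊆ξ (x∈⁅x⁆ _))

  stacked-unfresh⇒cycle : 1 ≤ n → Stacked L → Facet η → ¬ η ∈ₗ L → ∣ F ∣ ≡ n → F ⊆ η → Covered L F →
                          ∀ {x} → x ∈ η → x ∉ F → Covered L ⁅ x ⁆ → IsCycle K 0 n
  stacked-unfresh⇒cycle 1≤n st fη η∉L ∣F∣≡n F⊆η covF {x} x∈η x∉F covx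
    with stacked-linked st ∣F∣≡n covF (≤-trans (≤-reflexive (∣⁅x⁆∣≡1 x)) 1≤n) covx
  ... | inj₁ shared = ⊥-elim (¬sharedFacet st fη η∉L ∣F∣≡n F⊆η x∈η x∉F shared)
  ... | inj₂ c with steps c in steps≡
  ...   | suc _ = GalleryCycle.cycle 1≤n st fη η∉L F⊆η x∈η x∉F c (subst (1 ≤_) (sym steps≡) (s≤s z≤n))
  ...   | zero = ⊥-elim (¬sharedFacet st fη η∉L ∣F∣≡n F⊆η x∈η x∉F
                          ( facet c 0 , facet∈ c 0 z≤n
                          , subst (_⊆ facet c 0) (ridge-start c) (ridge⊆facet c 0 z≤n)
                          , subst (λ i → ⁅ x ⁆ ⊆ facet c i) steps≡ (target⊆last c)))

  chained⇒stacked⊎cycle : 1 ≤ n → Chained L → Stacked L ⊎ IsCycle K 0 n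
  chained⇒stacked⊎cycle _ (start fη) = inj₁ (start fη)
  chained⇒stacked⊎cycle 1≤n (extend {L} {η} ch fη η∉L F ∣F∣≡n F⊆η covF)
    with chained⇒stacked⊎cycle 1≤n ch | fresh? η L
  ... | inj₂ cycle | _ = inj₂ cycle
  ... | inj₁ st | yes (y , y∈η , fresh) = inj₁ (attach st fη F ∣F∣≡n F⊆η covF y y∈η fresh)
  ... | inj₁ st | no noFresh =
    let x , x∈η , x∉F = ∣p∣<∣q∣⇒∃x∈q∖p (subst₂ _<_ (sym ∣F∣≡n) (sym (proj₂ fη)) ≤-refl)
    in inj₂ (stacked-unfresh⇒cycle 1≤n st fη η∉L ∣F∣≡n F⊆η covF x∈η x∉F (¬fresh⇒verticesCovered noFresh x∈η))

  Stacked-++⁻ : ∀ pre → Stacked (pre ++ η ∷ L) → Stacked (η ∷ L)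
  Stacked-++⁻ [] st = st
  Stacked-++⁻ (_ ∷ []) (attach st _ _ _ _ _ _ _ _) = st
  Stacked-++⁻ (_ ∷ pre@(_ ∷ _)) (attach st _ _ _ _ _ _ _ _) = Stacked-++⁻ pre st

  _≟ˢ_ : DecidableEquality (Subset p)
  _≟ˢ_ = Vec.≡-dec Bool._≟_

  facet? : ∀ S → Dec (Facet S)
  facet? S = (mem K S Bool.≟ true) ×-dec (∣ S ∣ ≟ suc n)

  Complete : List (Subset p) → Set
  Complete L = ∀ {η} → Facet η → η ∈ₗ L

  Adjacent : List (Subset p) → Subset p → Set
  Adjacent L η = Any (λ θ → n ≤ ∣ η ∩ θ ∣) L

  Adjacent-intro : θ ∈ₗ L → ∣ S ∣ ≡ n → S ⊆ η → S ⊆ θ → Adjacent L η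
  Adjacent-intro {θ} {η = η} θ∈L ∣S∣≡n S⊆η S⊆θ =
    lose θ∈L (subst (_≤ ∣ η ∩ θ ∣) ∣S∣≡n (p⊆q⇒∣p∣≤∣q∣ (λ v∈S → x∈p∩q⁺ (S⊆η v∈S , S⊆θ v∈S))))

  Addable : List (Subset p) → Subset p → Set
  Addable L η = Facet η × ¬ η ∈ₗ L × Adjacent L η

  addable? : ∀ L η → Dec (Addable L η)
  addable? L η = facet? η ×-dec ¬? (anyList? (η ≟ˢ_) L) ×-dec anyList? (λ θ → n ≤? ∣ η ∩ θ ∣) L


  addable⇒ridge : Chained L → Addable L η → ∃ λ F → ∣ F ∣ ≡ n × F ⊆ η × Covered L F
  addable⇒ridge {L} {η} ch (fη , η∉L , adj) with find adj
  ... | θ , θ∈L , n≤∣η∩θ∣ = η ∩ θ , ≤-antisym ∣η∩θ∣≤n n≤∣η∩θ∣ , p∩q⊆p η θ , lose θ∈L (p∩q⊆q η θ)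
    where
    ∣η∩θ∣≤n : ∣ η ∩ θ ∣ ≤ n
    ∣η∩θ∣≤n with n <? ∣ η ∩ θ ∣
    ... | no n≮ = ≮⇒≥ n≮
    ... | yes n< = ⊥-elim (η∉L (subst (_∈ₗ L) (sym (facet-⊆⇒≡ fη (chained-facet ch θ∈L) η⊆θ)) θ∈L))
      where
      η⊆θ : η ⊆ θ
      η⊆θ v∈η = p∩q⊆q η θ (p⊆q∧∣q∣≤∣p∣⇒q⊆p (p∩q⊆p η θ) (subst (_≤ ∣ η ∩ θ ∣) (sym (proj₂ fη)) n<) v∈η)

  ridge-of : Facet θ → ∃ λ S → ∣ S ∣ ≡ n × S ⊆ θ
  ridge-of {θ} (_ , ∣θ∣≡1+n) =
    let x , x∈θ = ∣p∣≡1+k⇒Nonempty θ ∣θ∣≡1+n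
    in θ - x , suc-injective (trans (x∈p⇒1+∣p-x∣≡∣p∣ x∈θ) ∣θ∣≡1+n) , p─q⊆p θ ⁅ x ⁆

  -- Walking from a ridge of a facet of L to a ridge of the facet η, the first facet of the walk
  -- outside L is adjacent to L.
  connected⇒addable : 1 ≤ n → Connected K n → Chained L → Facet η → ¬ η ∈ₗ L → ∃ (Addable L)
  connected⇒addable {θ ∷ L′} {η} 1≤n connected ch fη η∉L with ridge-of (chained-facet ch (here refl)) | ridge-of fη
  ... | a , ∣a∣≡n , a⊆θ | b , ∣b∣≡n , b⊆η with a ≟ˢ b
  ...   | yes refl = η , fη , η∉L , Adjacent-intro (here refl) ∣b∣≡n b⊆η a⊆θ
  ...   | no a≢b with connected a b (ridge-simplex 1≤n ∣a∣≡n a⊆θ (chained-facet ch (here refl)))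
                                  (ridge-simplex 1≤n ∣b∣≡n b⊆η fη) a≢b
  ...     | r , σ , ηs , (σ-simplex , ηs-facet , walk) , σ1≡a , σr≡b , _ =
    finish (follow (suc r) (s≤s z≤n) ≤-refl)
    where
    ∣σ∣≡n : ∀ k → 1 ≤ k → k ≤ suc r → ∣ σ k ∣ ≡ n
    ∣σ∣≡n k 1≤k k≤ = trans (proj₂ (σ-simplex k 1≤k k≤)) (m+[n∸m]≡n 1≤n)
    follow : ∀ k → 1 ≤ k → k ≤ suc r → Covered (θ ∷ L′) (σ k) ⊎ ∃ (Addable (θ ∷ L′))
    follow (suc zero) _ _ = inj₁ (here (subst (_⊆ θ) (sym σ1≡a) a⊆θ))
    follow (suc (suc k)) _ (s≤s k<) with follow (suc k) (s≤s z≤n) (≤-trans (n≤1+n _) (s≤s k<))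
    ... | inj₂ found = inj₂ found
    ... | inj₁ covσ with walk (suc k) (s≤s z≤n) k< | anyList? (ηs (suc k) ≟ˢ_) (θ ∷ L′)
    ...   | _ , _ , σ⊆ηs | yes ηs∈L = inj₁ (lose ηs∈L σ⊆ηs)
    ...   | _ , σ⊆ηs , _ | no ηs∉L =
      let ζ , ζ∈L , σ⊆ζ = find covσ in
      inj₂ (ηs (suc k) , ηs-facet (suc k) (s≤s z≤n) k< , ηs∉L ,
            Adjacent-intro ζ∈L (∣σ∣≡n (suc k) (s≤s z≤n) (≤-trans (n≤1+n _) (s≤s k<))) σ⊆ηs σ⊆ζ)
    finish : Covered (θ ∷ L′) (σ (suc r)) ⊎ ∃ (Addable (θ ∷ L′)) → ∃ (Addable (θ ∷ L′))
    finish (inj₂ found) = found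
    finish (inj₁ covb) =
      let ζ , ζ∈L , b⊆ζ = find covb in η , fη , η∉L , Adjacent-intro ζ∈L ∣b∣≡n b⊆η (subst (_⊆ ζ) σr≡b b⊆ζ)

  facetᵇ : Subset p → Bool
  facetᵇ S = mem K S ∧ (∣ S ∣ ≡ᵇ suc n)

  facetᵇ-true : Facet η → facetᵇ η ≡ true
  facetᵇ-true (η∈K , ∣η∣≡1+n) = cong₂ _∧_ η∈K (trans (cong (_≡ᵇ suc n) ∣η∣≡1+n) (≡ᵇ-refl n))

  uncoveredFacets : List (Subset p) → ℕ
  uncoveredFacets L = count (λ S → facetᵇ S ∧ not (does (covered? L S)))

  uncoveredFacets-∷ : Chained L → Facet η → ¬ η ∈ₗ L → uncoveredFacets (η ∷ L) < uncoveredFacets L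
  uncoveredFacets-∷ {L} {η} ch fη η∉L = count-mono-< _ _ η still-uncovered η-uncovered η-covered
    where
    still-uncovered : ∀ S → facetᵇ S ∧ not (does (S ⊆? η) ∨ does (covered? L S)) ≡ true →
                      facetᵇ S ∧ not (does (covered? L S)) ≡ true
    still-uncovered S = weaken (facetᵇ S) (does (S ⊆? η)) (does (covered? L S))
      where
      weaken : ∀ a b c → a ∧ not (b ∨ c) ≡ true → a ∧ not c ≡ true
      weaken true false false _ = refl
    uncov : ¬ Covered L η
    uncov covη = let θ , θ∈L , η⊆θ = find covη in
      η∉L (subst (_∈ₗ L) (sym (facet-⊆⇒≡ fη (chained-facet ch θ∈L) η⊆θ)) θ∈L)
    η-uncovered : facetᵇ η ∧ not (does (covered? L η)) ≡ true
    η-uncovered = cong₂ (λ a b → a ∧ not b) (facetᵇ-true fη) (dec-false (covered? L η) uncov)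
    η-covered : facetᵇ η ∧ not (does (η ⊆? η) ∨ does (covered? L η)) ≡ false
    η-covered rewrite dec-true (η ⊆? η) ⊆-refl = ∧-zeroʳ _

  chained-complete : 1 ≤ n → Connected K n → Chained L → ∃ λ pre → Chained (pre ++ L) × Complete (pre ++ L)
  chained-complete {L} 1≤n connected ch = grow (suc (uncoveredFacets L)) ch ≤-refl
    where
    grow : ∀ fuel {L} → Chained L → uncoveredFacets L < fuel → ∃ λ pre → Chained (pre ++ L) × Complete (pre ++ L)
    grow (suc fuel) {L} ch bound with anyList? (addable? L) (allSubsets p)
    ... | yes some =
      let η , _ , addable = find some
          fη , η∉L , _ = addable
          F , ∣F∣≡n , F⊆η , covF = addable⇒ridge ch addable
          pre , ch′ , complete = grow fuel (extend ch fη η∉L F ∣F∣≡n F⊆η covF)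
                                   (<-≤-trans (uncoveredFacets-∷ ch fη η∉L) (≤-pred bound))
      in pre ++ η ∷ [] , subst (λ M → Chained M × Complete M) (sym (++-assoc pre (η ∷ []) L)) (ch′ , complete)
    ... | no none = [] , ch , complete
      where
      complete : Complete L
      complete {η} fη with anyList? (η ≟ˢ_) L
      ... | yes η∈L = η∈L
      ... | no η∉L = let η′ , addable = connected⇒addable 1≤n connected ch fη η∉L in
                     ⊥-elim (none (lose (∈-allSubsets η′) addable))

  -- The facets η r, …, η 1 of a simplicial cycle, listed latest first, are chained through the σ′ but
  -- not stacked: a fresh vertex of η r misses η 1 ⊇ σ 1, so σ 1 ⊆ η r lies in σ′ r ⊆ η (r ∸ 1).
  cycle⇒unstacked : 1 ≤ n → ∀ {m} → IsCycle K m n → ∃ λ θ → ∃ λ L → Chained (θ ∷ L) × ¬ Stacked (θ ∷ L)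
  cycle⇒unstacked 1≤n (r , σ , η , (_ , η-facet , walk) , closes , _ , η-distinct ,
                       s≤s (s≤s (s≤s (z≤n {r₀}))) , σ1⊈middle , σ′ , σ′-ridge , _) =
    η r , facets (r ∸ 1) , chained r (s≤s z≤n) ≤-refl , unstacked
    where
    facets : ℕ → List (Subset p)
    facets = applyDownFrom (η ∘ suc)
    σ′-between : ∀ z → 2 ≤ z → z ≤ r → ∣ σ′ z ∣ ≡ n × σ′ z ⊆ η z × σ′ z ⊆ η (z ∸ 1)
    σ′-between z 2≤z z≤r =
      let (_ , ∣σ′∣≡1+[n∸1]) , σ′⊆η , σ′⊆η-before , _ = σ′-ridge z 2≤z z≤r
      in trans ∣σ′∣≡1+[n∸1] (m+[n∸m]≡n 1≤n) , σ′⊆η , σ′⊆η-before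
    chained : ∀ j → 1 ≤ j → j ≤ r → Chained (facets j)
    chained (suc zero) _ 1≤r = start (η-facet 1 (s≤s z≤n) 1≤r)
    chained (suc (suc j)) _ 2+j≤r =
      let ∣σ′∣≡n , σ′⊆η , σ′⊆η-before = σ′-between (2 + j) (s≤s (s≤s z≤n)) 2+j≤r in
      extend (chained (suc j) (s≤s z≤n) (≤-trans (n≤1+n _) 2+j≤r)) (η-facet (2 + j) (s≤s z≤n) 2+j≤r) new
             (σ′ (2 + j)) ∣σ′∣≡n σ′⊆η (here σ′⊆η-before)
      where
      new : ¬ η (2 + j) ∈ₗ facets (suc j)
      new η∈ with ∈-applyDownFrom⁻ (η ∘ suc) η∈
      ... | i , i<1+j , η≡ = η-distinct (2 + j) (suc i) (s≤s z≤n) 2+j≤r (s≤s z≤n)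
                               (≤-trans (n≤1+n _) (≤-trans (s≤s i<1+j) 2+j≤r)) (λ { refl → <-irrefl refl i<1+j }) η≡
    unstacked : ¬ Stacked (η r ∷ facets (r ∸ 1))
    unstacked (attach _ fηr _ _ _ _ y y∈ηr fresh) = σ1⊈middle (r ∸ 1) (s≤s (s≤s z≤n)) ≤-refl σ1⊆η[r-1]
      where
      ∣σ′r∣≡n : ∣ σ′ r ∣ ≡ n
      ∣σ′r∣≡n = proj₁ (σ′-between r (s≤s (s≤s z≤n)) ≤-refl)
      σ′r⊆ηr : σ′ r ⊆ η r
      σ′r⊆ηr = proj₁ (proj₂ (σ′-between r (s≤s (s≤s z≤n)) ≤-refl))
      σ′r⊆η[r-1] : σ′ r ⊆ η (r ∸ 1)
      σ′r⊆η[r-1] = proj₂ (proj₂ (σ′-between r (s≤s (s≤s z≤n)) ≤-refl))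
      y∉σ′r : y ∉ σ′ r
      y∉σ′r = fresh⇒∉covered fresh (here σ′r⊆η[r-1])
      σ1⊆η1 : σ 1 ⊆ η 1
      σ1⊆η1 = proj₁ (proj₂ (walk 1 (s≤s z≤n) (s≤s z≤n)))
      σ1⊆ηr : σ 1 ⊆ η r
      σ1⊆ηr = subst (_⊆ η r) closes (proj₂ (proj₂ (walk r (s≤s z≤n) ≤-refl)))
      σ1⊆η[r-1] : σ 1 ⊆ η (r ∸ 1)
      σ1⊆η[r-1] {v} v∈σ1 with v ≟ᶠ y
      ... | yes refl = ⊥-elim (fresh⇒∉covered fresh (lose (∈-applyDownFrom⁺ (η ∘ suc) (s≤s z≤n)) ⊆-refl) (σ1⊆η1 v∈σ1))
      ... | no v≢y = σ′r⊆η[r-1] (∈facet∧≢apex⇒∈ridge fηr ∣σ′r∣≡n σ′r⊆ηr y∈ηr y∉σ′r (σ1⊆ηr v∈σ1) v≢y)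

α-0 : ∀ {p} (K : Complex p) → α K 0 ≡ p
α-0 {p} K = begin
  α K 0                           ≡⟨ count-cong vertex ⟩
  count (sizedSubsetᵇ (⊤ {p}) 1)  ≡⟨ count-sizedSubset (⊤ {p}) 1 ⟩
  ∣ ⊤ {p} ∣ C 1                   ≡⟨ cong (_C 1) (∣⊤∣≡n p) ⟩
  p C 1                           ≡⟨ nC1≡n p ⟩
  p                               ∎
  where
  open ≡-Reasoning
  vertex : ∀ S → mem K S ∧ (∣ S ∣ ≡ᵇ 1) ≡ sizedSubsetᵇ ⊤ 1 S
  vertex S with ∣ S ∣ ≡ᵇ 1 in ∣S∣≡ᵇ1
  ... | false = ∧-zeroʳ (mem K S)
  ... | true with ∣p∣≡1+k⇒Nonempty S (≡ᵇ-true⇒≡ ∣S∣≡ᵇ1)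
  ...   | x , x∈S rewrite ∣p∣≡1∧x∈p⇒p≡⁅x⁆ (≡ᵇ-true⇒≡ ∣S∣≡ᵇ1) x∈S | singletons K x | dec-true (⁅ x ⁆ ⊆? ⊤) ⊆⊤ = refl

module Tree {p : ℕ} (K : Complex p) (n : ℕ) (1≤n : 1 ≤ n) (pure : Pure K n) where
  open FacetLists K n

  n≤p : n ≤ p
  n≤p = let θ , _ , ∣θ∣≡1+n = proj₁ pure in ≤-trans (n≤1+n n) (subst (_≤ p) ∣θ∣≡1+n (∣p∣≤n θ))

  complete⇒faces≡α : ∀ {L} → Chained L → Complete L → ∀ k → faces k L ≡ α K k
  complete⇒faces≡α {L} ch complete k = count-cong same
    where
    covered≡mem : ∀ S → Nonempty S → does (covered? L S) ≡ mem K S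
    covered≡mem S nonempty with mem K S in S∈K
    ... | true = let θ , fθ , S⊆θ = proj₂ (proj₂ pure) S S∈K in dec-true (covered? L S) (lose (complete fθ) S⊆θ)
    ... | false = dec-false (covered? L S) λ covS →
      let θ , θ∈L , S⊆θ = find covS in
      case trans (sym S∈K) (closed K S θ (proj₁ (chained-facet ch θ∈L)) nonempty S⊆θ) of λ ()
    same : ∀ S → (∣ S ∣ ≡ᵇ suc k) ∧ does (covered? L S) ≡ mem K S ∧ (∣ S ∣ ≡ᵇ suc k)
    same S with ∣ S ∣ ≡ᵇ suc k in ∣S∣≡ᵇ1+k
    ... | false = sym (∧-zeroʳ (mem K S))
    ... | true = trans (covered≡mem S (∣p∣≡1+k⇒Nonempty S (≡ᵇ-true⇒≡ ∣S∣≡ᵇ1+k))) (sym (∧-identityʳ (mem K S)))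

  complete⇒balanced⇔count : ∀ {L} → Chained L → Complete L → ∀ k →
                            faceTally k L ≡ vertexTally k L ⇔ α K k ≡ (p ∸ n) * (n C k) + n C suc k
  complete⇒balanced⇔count {L} ch complete k = mk⇔
    (λ balanced → +-cancelʳ-≡ (n * c) (α K k) _ (trans (sym faces≡) (trans balanced (trans vertices≡ (sym shift)))))
    (λ count → trans faces≡ (trans (cong (_+ n * c) count) (trans shift (sym vertices≡))))
    where
    c d : ℕ
    c = n C k
    d = n C suc k
    faces≡ : faceTally k L ≡ α K k + n * c
    faces≡ = cong (_+ n * c) (complete⇒faces≡α ch complete k)
    vertices≡ : vertexTally k L ≡ p * c + d
    vertices≡ = cong (λ v → v * c + d) (trans (complete⇒faces≡α ch complete 0) (α-0 K))
    shift : (p ∸ n) * c + d + n * c ≡ p * c + d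
    shift = begin
      (p ∸ n) * c + d + n * c   ≡⟨ rearrange (p ∸ n) n c d ⟩
      (p ∸ n + n) * c + d       ≡⟨ cong (λ v → v * c + d) (m∸n+n≡m n≤p) ⟩
      p * c + d                 ∎
      where
      open ≡-Reasoning
      rearrange : ∀ a b c d → a * c + d + b * c ≡ (a + b) * c + d
      rearrange = solve-∀

  tree⇒count : Connected K n → Acyclic K n → α K n ≡ (p ∸ n) * (n C n) + n C suc n
  tree⇒count connected acyclic with chained-complete 1≤n connected (start (proj₂ (proj₁ pure)))
  ... | pre , ch , complete with chained⇒stacked⊎cycle 1≤n ch
  ...   | inj₂ cycle = ⊥-elim (acyclic 0 1≤n cycle)
  ...   | inj₁ st = Equivalence.to (complete⇒balanced⇔count ch complete n) (stacked-tally n st)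

  count⇒acyclic : Connected K n → ∀ k → 1 ≤ k → k ≤ n → α K k ≡ (p ∸ n) * (n C k) + n C suc k → Acyclic K n
  count⇒acyclic connected k 1≤k k≤n count m _ cycle with cycle⇒unstacked 1≤n cycle
  ... | θ , L , ch , unstacked with chained-complete 1≤n connected ch
  ...   | pre , ch′ , complete with chained⇒stacked⊎tally< k 1≤k k≤n ch′
  ...     | inj₁ st = unstacked (Stacked-++⁻ pre st)
  ...     | inj₂ tally< = <-irrefl (sym (Equivalence.from (complete⇒balanced⇔count ch′ complete k) count)) tally<

theorem5p4 : (n p : ℕ) → (K : Complex p) → 1 ≤ n → Pure K n →
    (SimplicialTree K n →
        Connected K n × Σ ℕ (λ k → 1 ≤ k × k ≤ n × α K k ≡ (p ∸ n) * (n C k) + (n C (suc k))))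
    × (Connected K n × Σ ℕ (λ k → 1 ≤ k × k ≤ n × α K k ≡ (p ∸ n) * (n C k) + (n C (suc k))) →
        SimplicialTree K n)
theorem5p4 n p K 1≤n pure =
  (λ (connected , acyclic , _) → connected , n , 1≤n , ≤-refl , tree⇒count connected acyclic) ,
  (λ (connected , k , 1≤k , k≤n , count) → connected , count⇒acyclic connected k 1≤k k≤n count , pure)
  where open Tree K n 1≤n pure
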